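{- Let $n\ge 3$ and let $K_n$ be the complete convex geometric graph whose vertices $P_1,\dots,P_n$ are listed in clockwise order, indices taken modulo $n$. Suppose $K_n$ can be covered by $t$ plane star-forests for some positive integer $t$. Then for every $k$ with $1<k<n$ there exists a covering of $K_n$ by $t$ plane star-forests $F_1,\dots,F_t$ such that for every $k'$ with $1<k'\le k$, every $k'$-edge is supported (with respect to $F_1,\dots,F_t$).
   Context: A geometric graph has points in the plane (no three collinear) as vertices and straight segments as edges; it is convex if the vertices are in convex position; the complete convex geometric graph contains all segments between vertices. A star is a vertex together with some edges incident to it (a single vertex is a star); a star-forest is a graph each of whose components is a star; a plane star-forest is one whose edges pairwise do not cross. A collection $F_1,\dots,F_t$ of plane star-forests (subgraphs of $K_n$) is a covering of $K_n$ if every edge of $K_n$ belongs to at least one $F_i$. For $1\le a\le n$ and $1<k<n$, the edge $P_aP_{a+k}$ is called a $k$-edge (so a $k$-edge is also an $(n-k)$-edge). A $k$-edge $P_aP_{a+k}$ is supported if there is an $F_i$ containing $P_aP_{a+k}$ such that either (i) all edges $P_aP_{a+1},P_aP_{a+2},\dots,P_aP_{a+k-1}$ belong to $F_i$, or (ii) all edges $P_{a+1}P_{a+k},P_{a+2}P_{a+k},\dots,P_{a+k-1}P_{a+k}$ belong to $F_i$; otherwise it is unsupported. -}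

module Defs where

open import Data.Nat using (ℕ; zero; suc; _+_; _≤_; _<_)
open import Data.Nat.DivMod using (_mod_)
open import Data.Fin using (Fin; toℕ) renaming (_<_ to _<ᶠ_)
open import Data.Product using (Σ; _×_; ∃; ∃-syntax)
open import Data.Sum using (_⊎_)
open import Data.Empty using (⊥)
open import Relation.Nullary using (¬_)
open import Relation.Binary.PropositionalEquality using (_≡_; _≢_)

-- Vertices P_0,...,P_{n-1} of the convex geometric graph K_n, listed
-- clockwise, are represented by Fin n.  (P_a with a ∈ {1..n} of the paper
-- corresponds to index a mod n.)

_⊕_ : {n : ℕ} → Fin n → ℕ → Fin n
_⊕_ {suc m} a k = (toℕ a + k) mod (suc m)

-- x lies strictly between a and b in the vertex order, i.e. on the
-- open arc between them not passing through index 0 (one of the two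
-- sides of the chord ab; which side is irrelevant for crossing).
StrictlyBetween : {n : ℕ} → Fin n → Fin n → Fin n → Set
StrictlyBetween a b x = (a <ᶠ x × x <ᶠ b) ⊎ (b <ᶠ x × x <ᶠ a)

Cross : {n : ℕ} → Fin n → Fin n → Fin n → Fin n → Set
Cross a b c d =
  a ≢ c × a ≢ d × b ≢ c × b ≢ d ×
  ((StrictlyBetween a b c × ¬ StrictlyBetween a b d) ⊎
   (¬ StrictlyBetween a b c × StrictlyBetween a b d))

-- A plane star-forest in K_n, given by its decomposition into stars:
-- Star c v means "the edge P_cP_v belongs to the star with centre P_c".
-- The components being stars means: no loops, a leaf is never a centre
-- (of a star with edges), and each leaf belongs to exactly one star.
record PlaneStarForest (n : ℕ) : Set₁ where
  field
    Star        : Fin n → Fin n → Set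
    irrefl      : ∀ {c v} → Star c v → c ≢ v
    leaf-no-ctr : ∀ {c v w} → Star c v → Star v w → ⊥
    uniq-ctr    : ∀ {c c′ v} → Star c v → Star c′ v → c ≡ c′
    noncrossing : ∀ {a b c d} → Star a b → Star c d → ¬ Cross a b c d

open PlaneStarForest public

HasEdge : {n : ℕ} → PlaneStarForest n → Fin n → Fin n → Set
HasEdge F a b = Star F a b ⊎ Star F b a

Covering : {n t : ℕ} → (Fin t → PlaneStarForest n) → Set
Covering {n} F = ∀ (a b : Fin n) → a ≢ b → ∃[ i ] HasEdge (F i) a b

Supported : {n t : ℕ} → (Fin t → PlaneStarForest n) → Fin n → ℕ → Set
Supported F a k =
  ∃[ i ] (HasEdge (F i) a (a ⊕ k) ×
          ((∀ j → 1 ≤ j → j < k → HasEdge (F i) a (a ⊕ j)) ⊎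
           (∀ j → 1 ≤ j → j < k → HasEdge (F i) (a ⊕ j) (a ⊕ k))))

-- Induction on k and, for a fixed k, on the vertices. To support the k-edge c b, take a forest F_i
-- containing it; reflecting the polygon if necessary, c is the centre of c b in F_i. Replace F_i by
-- the full fan of c over the arc c, c ⊕ 1, …, c ⊕ k together with the part of F_i outside the arc:
-- planarity forces every edge of F_i leaving the arc to end at c, so only the spokes of F_i inside
-- the arc need a new home. Let h be the largest distance from c of an endpoint of such a spoke. The
-- h-edge c (c ⊕ h) is already supported by some F_m. If F_m has its fan at c, the vertices c ⊕ 1, …,
-- c ⊕ h are leaves of c in F_m; their edges move to the new fan, and the inner spokes of F_i take
-- their place in F_m. If F_m has its fan at c ⊕ h, it already contains every edge of F_i at c ⊕ h,
-- which can therefore be deleted from F_i, and h decreases. Supports of shorter edges survive all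
-- these moves, since each is carried by a vertex with two neighbours whose edges move together.

module Submission where

open import Defs
open import Data.Empty using (⊥; ⊥-elim)
open import Data.Fin using (Fin; toℕ; fromℕ<; opposite) renaming (zero to fzero; _<_ to _<ᶠ_; _≟_ to _≟ᶠ_)
open import Data.Fin.Properties
  using (toℕ-fromℕ<; toℕ-injective; toℕ<n; opposite-prop; opposite-involutive; any?)
  renaming (<-cmp to <ᶠ-cmp; _<?_ to _<ᶠ?_; <-irrelevant to <ᶠ-irrelevant)
open import Data.Nat using (ℕ; zero; suc; pred; _+_; _∸_; _≤_; _<_; _<?_; _≤?_; _≟_; z≤n; s≤s; z<s; >-nonZero)
open import Data.Nat.DivMod using (_%_; m%n<n; m<n⇒m%n≡m; [m+n]%n≡m%n; %-distribˡ-+; m%n%n≡m%n)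
open import Data.Nat.Properties
open import Data.Product using (Σ; _×_; _,_; proj₁; proj₂; ∃; ∃-syntax; uncurry)
open import Data.Sum using (_⊎_; inj₁; inj₂; [_,_])
open import Data.Vec.Functional using (updateAt)
open import Data.Vec.Functional.Properties using (updateAt-updates; updateAt-minimal)
open import Function using (_∘_; id; const)
open import Function.Bundles using (_⇔_; mk⇔; Equivalence)
open import Function.Properties.Equivalence using () renaming (sym to ⇔-sym; trans to ⇔-trans)
open import Relation.Binary using (tri<; tri≈; tri>)
open import Relation.Binary.PropositionalEquality hiding ([_])
open import Relation.Nullary using (¬_; ¬?; Dec; yes; no; _×-dec_; _⊎-dec_; _→-dec_)
open import Relation.Nullary.Decidable using (map′; decidable-stable)

module Cycle (m : ℕ) where

  n : ℕ
  n = suc m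

  V : Set
  V = Fin n

  toℕ-⊕ : (a : V) (j : ℕ) → toℕ (a ⊕ j) ≡ (toℕ a + j) % n
  toℕ-⊕ a j = toℕ-fromℕ< (m%n<n (toℕ a + j) n)

  [m%n+k]%n≡[m+k]%n : ∀ x l → (x % n + l) % n ≡ (x + l) % n
  [m%n+k]%n≡[m+k]%n x l = begin
      (x % n + l) % n            ≡⟨ %-distribˡ-+ (x % n) l n ⟩
      (x % n % n + l % n) % n    ≡⟨ cong (λ z → (z + l % n) % n) (m%n%n≡m%n x n) ⟩
      (x % n + l % n) % n        ≡⟨ %-distribˡ-+ x l n ⟨
      (x + l) % n                ∎
    where open ≡-Reasoning

  [m+k%n]%n≡[m+k]%n : ∀ x l → (x + l % n) % n ≡ (x + l) % n
  [m+k%n]%n≡[m+k]%n x l = begin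
      (x + l % n) % n  ≡⟨ cong (_% n) (+-comm x (l % n)) ⟩
      (l % n + x) % n  ≡⟨ [m%n+k]%n≡[m+k]%n l x ⟩
      (l + x) % n      ≡⟨ cong (_% n) (+-comm l x) ⟩
      (x + l) % n      ∎
    where open ≡-Reasoning

  ⊕-assoc : (a : V) (j l : ℕ) → (a ⊕ j) ⊕ l ≡ a ⊕ (j + l)
  ⊕-assoc a j l = toℕ-injective (begin
      toℕ ((a ⊕ j) ⊕ l)         ≡⟨ toℕ-⊕ (a ⊕ j) l ⟩
      (toℕ (a ⊕ j) + l) % n     ≡⟨ cong (λ z → (z + l) % n) (toℕ-⊕ a j) ⟩
      ((toℕ a + j) % n + l) % n ≡⟨ [m%n+k]%n≡[m+k]%n (toℕ a + j) l ⟩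
      (toℕ a + j + l) % n       ≡⟨ cong (_% n) (+-assoc (toℕ a) j l) ⟩
      (toℕ a + (j + l)) % n     ≡⟨ toℕ-⊕ a (j + l) ⟨
      toℕ (a ⊕ (j + l))         ∎)
    where open ≡-Reasoning

  ⊕-identityʳ : (a : V) → a ⊕ 0 ≡ a
  ⊕-identityʳ a = toℕ-injective (trans (toℕ-⊕ a 0)
    (trans (cong (_% n) (+-identityʳ (toℕ a))) (m<n⇒m%n≡m (toℕ<n a))))

  ⊕-period : (a : V) → a ⊕ n ≡ a
  ⊕-period a = toℕ-injective (trans (toℕ-⊕ a n)
    (trans ([m+n]%n≡m%n (toℕ a) n) (m<n⇒m%n≡m (toℕ<n a))))

  offset : V → V → ℕ
  offset c x = (toℕ x + (n ∸ toℕ c)) % n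

  offset<n : ∀ c x → offset c x < n
  offset<n c x = m%n<n (toℕ x + (n ∸ toℕ c)) n

  c+x+[n∸c]≡x+n : ∀ (c : V) x → toℕ c + x + (n ∸ toℕ c) ≡ x + n
  c+x+[n∸c]≡x+n c x = begin
    toℕ c + x + (n ∸ toℕ c)    ≡⟨ cong (_+ (n ∸ toℕ c)) (+-comm (toℕ c) x) ⟩
    x + toℕ c + (n ∸ toℕ c)    ≡⟨ +-assoc x (toℕ c) _ ⟩
    x + (toℕ c + (n ∸ toℕ c))  ≡⟨ cong (x +_) (m+[n∸m]≡n (<⇒≤ (toℕ<n c))) ⟩
    x + n                      ∎
    where open ≡-Reasoning

  ⊕-offset : ∀ c x → c ⊕ offset c x ≡ x
  ⊕-offset c x = toℕ-injective (begin
      toℕ (c ⊕ offset c x)                      ≡⟨ toℕ-⊕ c (offset c x) ⟩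
      (toℕ c + (toℕ x + (n ∸ toℕ c)) % n) % n   ≡⟨ [m+k%n]%n≡[m+k]%n (toℕ c) _ ⟩
      (toℕ c + (toℕ x + (n ∸ toℕ c))) % n       ≡⟨ cong (_% n) (+-assoc (toℕ c) (toℕ x) _) ⟨
      (toℕ c + toℕ x + (n ∸ toℕ c)) % n         ≡⟨ cong (_% n) (c+x+[n∸c]≡x+n c (toℕ x)) ⟩
      (toℕ x + n) % n                           ≡⟨ [m+n]%n≡m%n (toℕ x) n ⟩
      toℕ x % n                                 ≡⟨ m<n⇒m%n≡m (toℕ<n x) ⟩
      toℕ x                                     ∎)
    where open ≡-Reasoning

  offset-⊕ : ∀ c j → offset c (c ⊕ j) ≡ j % n
  offset-⊕ c j = begin
      offset c (c ⊕ j)                      ≡⟨ cong (λ z → (z + (n ∸ toℕ c)) % n) (toℕ-⊕ c j) ⟩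
      ((toℕ c + j) % n + (n ∸ toℕ c)) % n   ≡⟨ [m%n+k]%n≡[m+k]%n (toℕ c + j) _ ⟩
      (toℕ c + j + (n ∸ toℕ c)) % n         ≡⟨ cong (_% n) (c+x+[n∸c]≡x+n c j) ⟩
      (j + n) % n                           ≡⟨ [m+n]%n≡m%n j n ⟩
      j % n                                 ∎
    where open ≡-Reasoning

  offset-⊕< : ∀ c {j} → j < n → offset c (c ⊕ j) ≡ j
  offset-⊕< c {j} j<n = trans (offset-⊕ c j) (m<n⇒m%n≡m j<n)

  ⊕-% : ∀ a j → a ⊕ (j % n) ≡ a ⊕ j
  ⊕-% a j = trans (cong (a ⊕_) (sym (offset-⊕ a j))) (⊕-offset a (a ⊕ j))

  offset-injective : ∀ c {x y} → offset c x ≡ offset c y → x ≡ y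
  offset-injective c {x} {y} eq = trans (sym (⊕-offset c x)) (trans (cong (c ⊕_) eq) (⊕-offset c y))

  ⊕-cancel-< : ∀ c {j l} → j < n → l < n → c ⊕ j ≡ c ⊕ l → j ≡ l
  ⊕-cancel-< c j<n l<n eq = trans (sym (offset-⊕< c j<n)) (trans (cong (offset c) eq) (offset-⊕< c l<n))

  offset-self : ∀ c → offset c c ≡ 0
  offset-self c = trans (cong (offset c) (sym (⊕-identityʳ c))) (offset-⊕< c (s≤s z≤n))

  offset≡0⇒≡ : ∀ c {x} → offset c x ≡ 0 → x ≡ c
  offset≡0⇒≡ c eq = offset-injective c (trans eq (sym (offset-self c)))

  ⊕-via-offset : ∀ c x j → x ⊕ j ≡ c ⊕ (offset c x + j)
  ⊕-via-offset c x j = trans (cong (_⊕ j) (sym (⊕-offset c x))) (⊕-assoc c (offset c x) j)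

  offset-shift : ∀ c x j → offset c (x ⊕ j) ≡ (offset c x + j) % n
  offset-shift c x j = trans (cong (offset c) (⊕-via-offset c x j)) (offset-⊕ c (offset c x + j))

  offset-via : ∀ c a x → offset c x ≡ (offset c a + offset a x) % n
  offset-via c a x = trans (cong (offset c) (sym (⊕-offset a x))) (offset-shift c a (offset a x))

module Crossing (m : ℕ) where
  open Cycle m
  open Equivalence

  Separates : Set → Set → Set
  Separates P Q = (P × ¬ Q) ⊎ (¬ P × Q)

  separates-cong : ∀ {P Q P′ Q′} → P ⇔ P′ → Q ⇔ Q′ → Separates P Q ⇔ Separates P′ Q′
  separates-cong p q = mk⇔ (transport p q) (transport (⇔-sym p) (⇔-sym q))
    where
      transport : ∀ {P Q P′ Q′} → P ⇔ P′ → Q ⇔ Q′ → Separates P Q → Separates P′ Q′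
      transport p q (inj₁ (x , ¬y)) = inj₁ (to p x , λ y → ¬y (from q y))
      transport p q (inj₂ (¬x , y)) = inj₂ ((λ x → ¬x (from p x)) , to q y)

  separates⇔separates-¬ : ∀ {P Q} → Dec P → Dec Q → Separates P Q ⇔ Separates (¬ P) (¬ Q)
  separates⇔separates-¬ {P} {Q} P? Q? = mk⇔ negate restore
    where
      negate : Separates P Q → Separates (¬ P) (¬ Q)
      negate (inj₁ (x , ¬y)) = inj₂ ((λ ¬x → ¬x x) , ¬y)
      negate (inj₂ (¬x , y)) = inj₁ (¬x , λ ¬y → ¬y y)
      restore : Separates (¬ P) (¬ Q) → Separates P Q
      restore (inj₁ (¬x , ¬¬y)) = inj₂ (¬x , decidable-stable Q? ¬¬y)
      restore (inj₂ (¬¬x , ¬y)) = inj₁ (decidable-stable P? ¬¬x , ¬y)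

  BetweenN : ℕ → ℕ → ℕ → Set
  BetweenN A B U = (A < U × U < B) ⊎ (B < U × U < A)

  CyclicN : ℕ → ℕ → ℕ → Set
  CyclicN A U B = (A < U × U < B) ⊎ (U < B × B < A) ⊎ (B < A × A < U)

  betweenN⇔cyclicN : ∀ {A B U} → A < B → BetweenN A B U ⇔ CyclicN A U B
  betweenN⇔cyclicN {A} {B} {U} A<B = mk⇔ forth back
    where
      forth : BetweenN A B U → CyclicN A U B
      forth (inj₁ p) = inj₁ p
      forth (inj₂ (B<U , U<A)) = ⊥-elim (<-asym A<B (<-trans B<U U<A))
      back : CyclicN A U B → BetweenN A B U
      back (inj₁ p) = inj₁ p
      back (inj₂ (inj₁ (_ , B<A))) = ⊥-elim (<-asym A<B B<A)
      back (inj₂ (inj₂ (B<A , _))) = ⊥-elim (<-asym A<B B<A)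

  betweenN⇔¬cyclicN : ∀ {A B U} → B < A → U ≢ A → U ≢ B → BetweenN A B U ⇔ (¬ CyclicN A U B)
  betweenN⇔¬cyclicN {A} {B} {U} B<A U≢A U≢B = mk⇔ forth back
    where
      forth : BetweenN A B U → ¬ CyclicN A U B
      forth (inj₁ (A<U , U<B)) _ = <-asym B<A (<-trans A<U U<B)
      forth (inj₂ (_ , U<A)) (inj₁ (A<U , _)) = <-asym A<U U<A
      forth (inj₂ (B<U , _)) (inj₂ (inj₁ (U<B , _))) = <-asym B<U U<B
      forth (inj₂ (_ , U<A)) (inj₂ (inj₂ (_ , A<U))) = <-asym A<U U<A
      back : ¬ CyclicN A U B → BetweenN A B U
      back ¬cyc with <-cmp U B | <-cmp U A
      ... | tri< U<B _ _ | _            = ⊥-elim (¬cyc (inj₂ (inj₁ (U<B , B<A))))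
      ... | tri≈ _ U≡B _ | _            = ⊥-elim (U≢B U≡B)
      ... | tri> _ _ B<U | tri< U<A _ _ = inj₂ (B<U , U<A)
      ... | tri> _ _ _   | tri≈ _ U≡A _ = ⊥-elim (U≢A U≡A)
      ... | tri> _ _ _   | tri> _ _ A<U = ⊥-elim (¬cyc (inj₂ (inj₂ (B<A , A<U))))

  data OffsetSum (A D U : ℕ) : Set where
    noWrap : A ≤ U → A + D ≡ U → OffsetSum A D U
    wrap   : U < A → A + D ≡ U + n → OffsetSum A D U

  %-wrap : ∀ x → n ≤ x → x < n + n → x % n + n ≡ x
  %-wrap x n≤x x<2n = begin
    x % n + n              ≡⟨ cong (λ z → z % n + n) (m∸n+n≡m n≤x) ⟨
    (x ∸ n + n) % n + n    ≡⟨ cong (_+ n) ([m+n]%n≡m%n (x ∸ n) n) ⟩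
    (x ∸ n) % n + n        ≡⟨ cong (_+ n) (m<n⇒m%n≡m (m<n+o⇒m∸n<o x n x<2n)) ⟩
    x ∸ n + n              ≡⟨ m∸n+n≡m n≤x ⟩
    x                      ∎
    where open ≡-Reasoning

  offsetSum : ∀ c a x → OffsetSum (offset c a) (offset a x) (offset c x)
  offsetSum c a x with offset c a + offset a x <? n
  ... | yes lt = noWrap (subst (offset c a ≤_) (sym noWrap≡) (m≤m+n _ _)) (sym noWrap≡)
    where
      noWrap≡ : offset c x ≡ offset c a + offset a x
      noWrap≡ = trans (offset-via c a x) (m<n⇒m%n≡m lt)
  ... | no ¬lt = wrap (+-cancelʳ-< _ _ _ (subst (_< offset c a + n) wrap≡ (+-monoʳ-< _ (offset<n a x)))) wrap≡
    where
      wrap≡ : offset c a + offset a x ≡ offset c x + n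
      wrap≡ = trans (sym (%-wrap _ (≮⇒≥ ¬lt) (+-mono-< (offset<n c a) (offset<n a x))))
                    (cong (_+ n) (sym (offset-via c a x)))

  0<summand : ∀ {A D} → A < A + D → 0 < D
  0<summand {A} {D} lt = +-cancelˡ-< A 0 D (subst (_< A + D) (sym (+-identityʳ A)) lt)

  -- Seen from A, the points U and B lie at clockwise distances Du and Db.
  offsetSums⇒cyclicN : ∀ {A Du U Db B} → A < n → U < n → B < n → U ≢ A →
    OffsetSum A Du U → OffsetSum A Db B → (0 < Du × Du < Db) ⇔ CyclicN A U B
  offsetSums⇒cyclicN {A} {Du} {U} {Db} {B} A<n U<n B<n U≢A = cases
    where
      A<U⇒0<Du : A + Du ≡ U → A < U → 0 < Du
      A<U⇒0<Du eu A<U = 0<summand (subst (A <_) (sym eu) A<U)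
      cases : OffsetSum A Du U → OffsetSum A Db B → (0 < Du × Du < Db) ⇔ CyclicN A U B
      cases (noWrap A≤U eu) (noWrap A≤B eb) = mk⇔
        (λ (0<Du , Du<Db) → inj₁ (subst (A <_) eu (m<m+n A 0<Du) , subst₂ _<_ eu eb (+-monoʳ-< A Du<Db)))
        λ { (inj₁ (A<U , U<B))         → A<U⇒0<Du eu A<U , +-cancelˡ-< A _ _ (subst₂ _<_ (sym eu) (sym eb) U<B)
          ; (inj₂ (inj₁ (_ , B<A)))    → ⊥-elim (<⇒≱ B<A A≤B)
          ; (inj₂ (inj₂ (B<A , _)))    → ⊥-elim (<⇒≱ B<A A≤B) }
      cases (noWrap A≤U eu) (wrap B<A eb) = mk⇔
        (λ (0<Du , _) → inj₂ (inj₂ (B<A , subst (A <_) eu (m<m+n A 0<Du))))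
        λ _ → A<U⇒0<Du eu A<U ,
              +-cancelˡ-< A _ _ (subst₂ _<_ (sym eu) (sym eb) (<-≤-trans U<n (m≤n+m n B)))
        where
          A<U : A < U
          A<U = ≤∧≢⇒< A≤U (λ A≡U → U≢A (sym A≡U))
      cases (wrap U<A eu) (noWrap A≤B eb) = mk⇔
        (λ (_ , Du<Db) → ⊥-elim (<-asym (<-≤-trans B<n (m≤n+m n U)) (subst₂ _<_ eu eb (+-monoʳ-< A Du<Db))))
        λ { (inj₁ (A<U , _))        → ⊥-elim (<-asym A<U U<A)
          ; (inj₂ (inj₁ (_ , B<A))) → ⊥-elim (<⇒≱ B<A A≤B)
          ; (inj₂ (inj₂ (B<A , _))) → ⊥-elim (<⇒≱ B<A A≤B) }
      cases (wrap U<A eu) (wrap B<A eb) = mk⇔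
        (λ (_ , Du<Db) → inj₂ (inj₁ (+-cancelʳ-< _ _ _ (subst₂ _<_ eu eb (+-monoʳ-< A Du<Db)) , B<A)))
        λ { (inj₁ (A<U , _))        → ⊥-elim (<-asym A<U U<A)
          ; (inj₂ (inj₁ (U<B , _))) → 0<summand (subst (A <_) (sym eu) (<-≤-trans A<n (m≤n+m n U))) ,
                                      +-cancelˡ-< A _ _ (subst₂ _<_ (sym eu) (sym eb) (+-monoˡ-< n U<B))
          ; (inj₂ (inj₂ (_ , A<U))) → ⊥-elim (<-asym A<U U<A) }

  Cyclic : V → V → V → Set
  Cyclic a u b = 0 < offset a u × offset a u < offset a b

  cyclic? : ∀ a u b → Dec (Cyclic a u b)
  cyclic? a u b = (0 <? offset a u) ×-dec (offset a u <? offset a b)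

  cyclic⇔cyclicN : ∀ c {a u b} → u ≢ a → Cyclic a u b ⇔ CyclicN (offset c a) (offset c u) (offset c b)
  cyclic⇔cyclicN c {a} {u} {b} u≢a =
    offsetSums⇒cyclicN (offset<n c a) (offset<n c u) (offset<n c b) (λ eq → u≢a (offset-injective c eq))
      (offsetSum c a u) (offsetSum c a b)

  Between : V → V → V → V → Set
  Between c a b x = BetweenN (offset c a) (offset c b) (offset c x)

  between⇔cyclic : ∀ c {a b x} → offset c a < offset c b → x ≢ a → Between c a b x ⇔ Cyclic a x b
  between⇔cyclic c {a} {b} {x} a<b x≢a = ⇔-trans (betweenN⇔cyclicN a<b) (⇔-sym (cyclic⇔cyclicN c {a} {x} {b} x≢a))

  between⇔¬cyclic : ∀ c {a b x} → offset c b < offset c a → x ≢ a → x ≢ b →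
                    Between c a b x ⇔ (¬ Cyclic a x b)
  between⇔¬cyclic c {a} {b} {x} b<a x≢a x≢b = ⇔-trans
    (betweenN⇔¬cyclicN b<a (λ eq → x≢a (offset-injective c eq)) (λ eq → x≢b (offset-injective c eq)))
    (mk⇔ (λ ¬cyc cyc → ¬cyc (to e cyc)) (λ ¬cyc cyc → ¬cyc (from e cyc)))
    where
      e : Cyclic a x b ⇔ CyclicN (offset c a) (offset c x) (offset c b)
      e = cyclic⇔cyclicN c {a} {x} {b} x≢a

  separates-between⇔separates-cyclic : ∀ c {a b u w} → a ≢ b → u ≢ a → u ≢ b → w ≢ a → w ≢ b →
    Separates (Between c a b u) (Between c a b w) ⇔ Separates (Cyclic a u b) (Cyclic a w b)
  separates-between⇔separates-cyclic c {a} {b} {u} {w} a≢b u≢a u≢b w≢a w≢b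
    with <-cmp (offset c a) (offset c b)
  ... | tri< a<b _ _ = separates-cong (between⇔cyclic c {a} {b} {u} a<b u≢a) (between⇔cyclic c {a} {b} {w} a<b w≢a)
  ... | tri≈ _ a≡b _ = ⊥-elim (a≢b (offset-injective c a≡b))
  ... | tri> _ _ b<a = ⇔-trans (separates-cong (between⇔¬cyclic c {a} {b} {u} b<a u≢a u≢b)
                                                (between⇔¬cyclic c {a} {b} {w} b<a w≢a w≢b))
                               (⇔-sym (separates⇔separates-¬ (cyclic? a u b) (cyclic? a w b)))

  offset-fzero : ∀ x → offset fzero x ≡ toℕ x
  offset-fzero x = trans ([m+n]%n≡m%n (toℕ x) n) (m<n⇒m%n≡m (toℕ<n x))

  strictlyBetween⇔between : ∀ a b x → StrictlyBetween a b x ⇔ Between fzero a b x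
  strictlyBetween⇔between a b x = same (offset-fzero a) (offset-fzero b) (offset-fzero x)
    where
      same : ∀ {A B X} → A ≡ toℕ a → B ≡ toℕ b → X ≡ toℕ x → StrictlyBetween a b x ⇔ BetweenN A B X
      same refl refl refl = mk⇔ id id

  strictlyBetween-irrefl : ∀ (a x : V) → ¬ StrictlyBetween a a x
  strictlyBetween-irrefl a x (inj₁ (a<x , x<a)) = <-asym a<x x<a
  strictlyBetween-irrefl a x (inj₂ (a<x , x<a)) = <-asym a<x x<a

  cross⇒≢ : ∀ {a b u w : V} → Cross a b u w → a ≢ b
  cross⇒≢ {a} {u = u} (_ , _ , _ , _ , inj₁ (between , _)) refl = strictlyBetween-irrefl a u between
  cross⇒≢ {a} {w = w} (_ , _ , _ , _ , inj₂ (_ , between)) refl = strictlyBetween-irrefl a w between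

  -- Separation by a chord only depends on the cyclic order, hence not on the base point.
  separates-rebase : ∀ c d {a b u w} → a ≢ b → a ≢ u → a ≢ w → b ≢ u → b ≢ w →
    Separates (Between c a b u) (Between c a b w) → Separates (Between d a b u) (Between d a b w)
  separates-rebase c d {a} {b} {u} {w} a≢b a≢u a≢w b≢u b≢w = to (⇔-trans (cyc c) (⇔-sym (cyc d)))
    where
      cyc : ∀ e → Separates (Between e a b u) (Between e a b w) ⇔ Separates (Cyclic a u b) (Cyclic a w b)
      cyc e = separates-between⇔separates-cyclic e a≢b (≢-sym a≢u) (≢-sym b≢u) (≢-sym a≢w) (≢-sym b≢w)

  cross⇒separates : ∀ c {a b u w} → Cross a b u w → Separates (Between c a b u) (Between c a b w)
  cross⇒separates c {a} {b} {u} {w} cross@(a≢u , a≢w , b≢u , b≢w , separated) =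
    separates-rebase fzero c {a} {b} {u} {w} (cross⇒≢ cross) a≢u a≢w b≢u b≢w
      (to (separates-cong (strictlyBetween⇔between a b u) (strictlyBetween⇔between a b w)) separated)

  separates⇒cross : ∀ c {a b u w} → a ≢ b → a ≢ u → a ≢ w → b ≢ u → b ≢ w →
    Separates (Between c a b u) (Between c a b w) → Cross a b u w
  separates⇒cross c {a} {b} {u} {w} a≢b a≢u a≢w b≢u b≢w separated =
    a≢u , a≢w , b≢u , b≢w ,
    from (separates-cong (strictlyBetween⇔between a b u) (strictlyBetween⇔between a b w))
      (separates-rebase c fzero {a} {b} {u} {w} a≢b a≢u a≢w b≢u b≢w separated)

module Forests (m : ℕ) where
  open Cycle m

  record DecForest : Set₁ where
    field
      forest : PlaneStarForest n
      star?  : ∀ x y → Dec (Star forest x y)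
  open DecForest public

  Spoke : DecForest → V → V → Set
  Spoke D = Star (forest D)

  Edge : DecForest → V → V → Set
  Edge D = HasEdge (forest D)

  edge? : ∀ D x y → Dec (Edge D x y)
  edge? D x y = star? D x y ⊎-dec star? D y x

  edge-sym : ∀ {D x y} → Edge D x y → Edge D y x
  edge-sym (inj₁ s) = inj₂ s
  edge-sym (inj₂ s) = inj₁ s

  edge⇒≢ : ∀ {D x y} → Edge D x y → x ≢ y
  edge⇒≢ {D} (inj₁ s) = irrefl (forest D) s
  edge⇒≢ {D} (inj₂ s) = irrefl (forest D) s ∘ sym

  leaf-neighbour : ∀ D {c v y} → Spoke D c v → Edge D v y → y ≡ c
  leaf-neighbour D s (inj₁ s′) = ⊥-elim (leaf-no-ctr (forest D) s s′)
  leaf-neighbour D s (inj₂ s′) = uniq-ctr (forest D) s′ s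

  two-neighbours⇒centre : ∀ D {v x y} → Edge D v x → Edge D v y → x ≢ y → Spoke D v x
  two-neighbours⇒centre D (inj₁ s) _ _ = s
  two-neighbours⇒centre D (inj₂ s) e x≢y = ⊥-elim (x≢y (sym (leaf-neighbour D s e)))

  restrict : (D : DecForest) (P : V → V → Set) → (∀ x y → Dec (P x y)) →
             (∀ {x y} → P x y → Spoke D x y) → DecForest
  restrict D P P? P⊆D = record
    { forest = record
      { Star        = P
      ; irrefl      = irrefl (forest D) ∘ P⊆D
      ; leaf-no-ctr = λ p q → leaf-no-ctr (forest D) (P⊆D p) (P⊆D q)
      ; uniq-ctr    = λ p q → uniq-ctr (forest D) (P⊆D p) (P⊆D q)
      ; noncrossing = λ p q → noncrossing (forest D) (P⊆D p) (P⊆D q) }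
    ; star? = P? }

  BoundedAll : (ℕ → Set) → ℕ → Set
  BoundedAll P k = ∀ j → 1 ≤ j → j < k → P j

  boundedAll? : ∀ {P} → (∀ j → Dec (P j)) → ∀ k → Dec (BoundedAll P k)
  boundedAll? P? k = map′ (λ all j 1≤j j<k → all j<k 1≤j) (λ all {j} j<k 1≤j → all j 1≤j j<k)
                          (allUpTo? (λ j → (1 ≤? j) →-dec P? j) k)

  SupportedIn : DecForest → V → ℕ → Set
  SupportedIn D a k = Edge D a (a ⊕ k) ×
    (BoundedAll (λ j → Edge D a (a ⊕ j)) k ⊎ BoundedAll (λ j → Edge D (a ⊕ j) (a ⊕ k)) k)

  supportedIn-map : ∀ {D D′ a k} → (∀ {x y} → Edge D x y → Edge D′ x y) → SupportedIn D a k → SupportedIn D′ a k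
  supportedIn-map f (e , inj₁ fan) = f e , inj₁ (λ j 1≤j j<k → f (fan j 1≤j j<k))
  supportedIn-map f (e , inj₂ fan) = f e , inj₂ (λ j 1≤j j<k → f (fan j 1≤j j<k))

  Family : ℕ → Set₁
  Family t = Fin t → DecForest

  module _ {t : ℕ} where

    Covers : Family t → Set
    Covers Fs = Covering (forest ∘ Fs)

    SupportedBy : Family t → V → ℕ → Set
    SupportedBy Fs = Supported (forest ∘ Fs)

    supportedBy? : ∀ Fs a k → Dec (SupportedBy Fs a k)
    supportedBy? Fs a k = any? λ i → edge? (Fs i) a (a ⊕ k) ×-dec
      (boundedAll? (λ j → edge? (Fs i) a (a ⊕ j)) k ⊎-dec boundedAll? (λ j → edge? (Fs i) (a ⊕ j) (a ⊕ k)) k)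

    Preserves : ℕ → Family t → Family t → Set
    Preserves k Fs Fs′ = ∀ k′ a → 2 ≤ k′ → k′ ≤ k → SupportedBy Fs a k′ → SupportedBy Fs′ a k′

    SupportedBelow : ℕ → Family t → Set
    SupportedBelow k Fs = ∀ k′ → 2 ≤ k′ → k′ < k → ∀ a → SupportedBy Fs a k′

    Repaired : ℕ → V → Family t → Set₁
    Repaired k c Fs = Σ (Family t) λ Fs′ → Covers Fs′ × Preserves k Fs Fs′ × SupportedBy Fs′ c k

    preserves-below : ∀ {k Fs Fs′} → Preserves k Fs Fs′ → SupportedBelow k Fs → SupportedBelow k Fs′
    preserves-below pres below k′ 2≤k′ k′<k a = pres k′ a 2≤k′ (<⇒≤ k′<k) (below k′ 2≤k′ k′<k a)

    _[_≔_] : Family t → Fin t → DecForest → Family t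
    Fs [ i ≔ D ] = updateAt Fs i (const D)

    ≔-here : ∀ Fs i D → (Fs [ i ≔ D ]) i ≡ D
    ≔-here Fs i D = updateAt-updates i Fs

    ≔-there : ∀ Fs {i j} D → j ≢ i → (Fs [ i ≔ D ]) j ≡ Fs j
    ≔-there Fs {i} {j} D j≢i = updateAt-minimal j i Fs j≢i

    edge-in : ∀ (Fs : Family t) p {D x y} → Fs p ≡ D → Edge D x y → ∃[ q ] Edge (Fs q) x y
    edge-in Fs p refl e = p , e

    supportedIn-in : ∀ (Fs : Family t) p {D a k} → Fs p ≡ D → SupportedIn D a k → SupportedBy Fs a k
    supportedIn-in Fs p refl s = p , s

    covers-redistribute : ∀ Fs Fs′ → Covers Fs → (∀ p {x y} → Edge (Fs p) x y → ∃[ q ] Edge (Fs′ q) x y) → Covers Fs′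
    covers-redistribute _ _ cov move x y x≢y = move (proj₁ (cov x y x≢y)) (proj₂ (cov x y x≢y))

    supportedBy-redistribute : ∀ Fs Fs′ {a k} → (∀ p → SupportedIn (Fs p) a k → SupportedBy Fs′ a k) →
                               SupportedBy Fs a k → SupportedBy Fs′ a k
    supportedBy-redistribute _ _ move (p , s) = move p s

  without : DecForest → V → DecForest
  without D q = restrict D (λ x y → Spoke D x y × x ≢ q × y ≢ q)
    (λ x y → star? D x y ×-dec ¬? (x ≟ᶠ q) ×-dec ¬? (y ≟ᶠ q)) proj₁

  TwoNeighbours : DecForest → V → Set
  TwoNeighbours D v = Σ V λ w₁ → Σ V λ w₂ → w₁ ≢ w₂ × Edge D v w₁ × Edge D v w₂

  _⊆_at_ : DecForest → DecForest → V → Set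
  D ⊆ D′ at v = ∀ {w} → Edge D v w → Edge D′ v w

  module _ {D : DecForest} {a : V} {k : ℕ} (2≤k : 2 ≤ k) (k<n : k < n) (e : Edge D a (a ⊕ k)) where

    a⊕1≢a⊕k : a ⊕ 1 ≢ a ⊕ k
    a⊕1≢a⊕k eq = <-irrefl (⊕-cancel-< a {1} {k} (<-trans 2≤k k<n) k<n eq) 2≤k

    a≢a⊕1 : a ≢ a ⊕ 1
    a≢a⊕1 eq = 0≢1+n (⊕-cancel-< a {0} {1} (s≤s z≤n) (<-trans 2≤k k<n) (trans (⊕-identityʳ a) eq))

    outward-apex : BoundedAll (λ j → Edge D a (a ⊕ j)) k → TwoNeighbours D a
    outward-apex fan = a ⊕ 1 , a ⊕ k , a⊕1≢a⊕k , fan 1 ≤-refl 2≤k , e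

    inward-apex : BoundedAll (λ j → Edge D (a ⊕ j) (a ⊕ k)) k → TwoNeighbours D (a ⊕ k)
    inward-apex fan = a , a ⊕ 1 , a≢a⊕1 , edge-sym {D} e , edge-sym {D} (fan 1 ≤-refl 2≤k)

  outward-moves : ∀ {D D′ a k} → Edge D a (a ⊕ k) → BoundedAll (λ j → Edge D a (a ⊕ j)) k →
                  D ⊆ D′ at a → SupportedIn D′ a k
  outward-moves e fan move = move e , inj₁ (λ j 1≤j j<k → move (fan j 1≤j j<k))

  inward-moves : ∀ {D D′ a k} → Edge D a (a ⊕ k) → BoundedAll (λ j → Edge D (a ⊕ j) (a ⊕ k)) k →
                 D ⊆ D′ at (a ⊕ k) → SupportedIn D′ a k
  inward-moves {D} {D′} e fan move =
    edge-sym {D′} (move (edge-sym {D} e)) , inj₂ (λ j 1≤j j<k → edge-sym {D′} (move (edge-sym {D} (fan j 1≤j j<k))))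

  -- A support is carried along by the edges at its apex, a vertex with two neighbours.
  supportedIn-split : ∀ {D D₁ D₂ a k} → 2 ≤ k → k < n → SupportedIn D a k →
    (∀ v → TwoNeighbours D v → D ⊆ D₁ at v ⊎ D ⊆ D₂ at v) → SupportedIn D₁ a k ⊎ SupportedIn D₂ a k
  supportedIn-split {D} {D₁} {D₂} {a} {k} 2≤k k<n (e , inj₁ fan) split
    with split a (outward-apex {D} {a} {k} 2≤k k<n e fan)
  ... | inj₁ move = inj₁ (outward-moves {D} {D₁} {a} {k} e fan move)
  ... | inj₂ move = inj₂ (outward-moves {D} {D₂} {a} {k} e fan move)
  supportedIn-split {D} {D₁} {D₂} {a} {k} 2≤k k<n (e , inj₂ fan) split
    with split (a ⊕ k) (inward-apex {D} {a} {k} 2≤k k<n e fan)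
  ... | inj₁ move = inj₁ (inward-moves {D} {D₁} {a} {k} e fan move)
  ... | inj₂ move = inj₂ (inward-moves {D} {D₂} {a} {k} e fan move)

  inward-edges : ∀ {D a k} → Edge D a (a ⊕ k) → BoundedAll (λ j → Edge D (a ⊕ j) (a ⊕ k)) k →
                 ∀ j → j < k → Edge D (a ⊕ j) (a ⊕ k)
  inward-edges {D} {a} {k} e fan zero    _   = subst (λ z → Edge D z (a ⊕ k)) (sym (⊕-identityʳ a)) e
  inward-edges             e fan (suc j) j<k = fan (suc j) (s≤s z≤n) j<k

  inward-support : ∀ {D a k} → 0 < k → (∀ {j} → j < k → Edge D (a ⊕ j) (a ⊕ k)) → SupportedIn D a k
  inward-support {D} {a} {k} 0<k edges =
    subst (λ z → Edge D z (a ⊕ k)) (⊕-identityʳ a) (edges 0<k) , inj₂ (λ j _ j<k → edges j<k)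

module Reflection (m : ℕ) where
  open Cycle m
  open Forests m
  open Crossing m using (Separates)

  op : V → V
  op = opposite

  op-injective : ∀ {x y} → op x ≡ op y → x ≡ y
  op-injective {x} {y} eq = trans (sym (opposite-involutive x)) (trans (cong op eq) (opposite-involutive y))

  op-reverses-< : ∀ {x y : V} → toℕ x < toℕ y → toℕ (op y) < toℕ (op x)
  op-reverses-< {x} {y} x<y = subst₂ _<_ (sym (opposite-prop y)) (sym (opposite-prop x))
    (∸-monoʳ-< x<y (≤-pred (toℕ<n y)))

  op-strictlyBetween : ∀ {a b x} → StrictlyBetween a b x → StrictlyBetween (op a) (op b) (op x)
  op-strictlyBetween (inj₁ (a<x , x<b)) = inj₂ (op-reverses-< x<b , op-reverses-< a<x)
  op-strictlyBetween (inj₂ (b<x , x<a)) = inj₁ (op-reverses-< x<a , op-reverses-< b<x)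

  op-strictlyBetween⁻ : ∀ {a b x} → StrictlyBetween (op a) (op b) (op x) → StrictlyBetween a b x
  op-strictlyBetween⁻ {a} {b} {x} between =
    subst₂ (λ u v → StrictlyBetween u v x) (opposite-involutive a) (opposite-involutive b)
      (subst (StrictlyBetween (op (op a)) (op (op b))) (opposite-involutive x) (op-strictlyBetween between))

  op-cross : ∀ {a b u w} → Cross a b u w → Cross (op a) (op b) (op u) (op w)
  op-cross {a} {b} {u} {w} (a≢u , a≢w , b≢u , b≢w , separated) =
    a≢u ∘ op-injective , a≢w ∘ op-injective , b≢u ∘ op-injective , b≢w ∘ op-injective , reflected separated
    where
      reflected : Separates (StrictlyBetween a b u) (StrictlyBetween a b w) →
                  Separates (StrictlyBetween (op a) (op b) (op u)) (StrictlyBetween (op a) (op b) (op w))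
      reflected (inj₁ (su , ¬sw)) = inj₁ (op-strictlyBetween su , ¬sw ∘ op-strictlyBetween⁻)
      reflected (inj₂ (¬su , sw)) = inj₂ (¬su ∘ op-strictlyBetween⁻ , op-strictlyBetween sw)

  -- Reflection reverses the orientation of the circle.
  offset-op : ∀ x y → offset (op y) (op x) ≡ offset x y
  offset-op x y = cong (_% n) (begin
      toℕ (op x) + (n ∸ toℕ (op y))   ≡⟨ cong₂ (λ u v → u + (n ∸ v)) (opposite-prop x) (opposite-prop y) ⟩
      (m ∸ toℕ x) + (n ∸ (m ∸ toℕ y)) ≡⟨ cong ((m ∸ toℕ x) +_) (+-∸-assoc 1 (m∸n≤m m (toℕ y))) ⟩
      (m ∸ toℕ x) + suc (m ∸ (m ∸ toℕ y)) ≡⟨ cong (λ z → (m ∸ toℕ x) + suc z) (m∸[m∸n]≡n y≤m) ⟩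
      (m ∸ toℕ x) + suc (toℕ y)       ≡⟨ +-suc (m ∸ toℕ x) (toℕ y) ⟩
      suc (m ∸ toℕ x) + toℕ y         ≡⟨ +-comm (suc (m ∸ toℕ x)) (toℕ y) ⟩
      toℕ y + suc (m ∸ toℕ x)         ≡⟨ cong (toℕ y +_) (+-∸-assoc 1 x≤m) ⟨
      toℕ y + (n ∸ toℕ x)             ∎)
    where
      open ≡-Reasoning
      x≤m : toℕ x ≤ m
      x≤m = ≤-pred (toℕ<n x)
      y≤m : toℕ y ≤ m
      y≤m = ≤-pred (toℕ<n y)

  op-⊕-⊕ : ∀ x j → op (x ⊕ j) ⊕ j ≡ op x
  op-⊕-⊕ x j = begin
    op (x ⊕ j) ⊕ j                         ≡⟨ ⊕-% (op (x ⊕ j)) j ⟨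
    op (x ⊕ j) ⊕ (j % n)                   ≡⟨ cong (op (x ⊕ j) ⊕_) (offset-⊕ x j) ⟨
    op (x ⊕ j) ⊕ offset x (x ⊕ j)          ≡⟨ cong (op (x ⊕ j) ⊕_) (offset-op x (x ⊕ j)) ⟨
    op (x ⊕ j) ⊕ offset (op (x ⊕ j)) (op x) ≡⟨ ⊕-offset (op (x ⊕ j)) (op x) ⟩
    op x                                   ∎
    where open ≡-Reasoning

  -- The k-edge from a is mirrored onto the k-edge from op (a ⊕ k).
  mirror : V → ℕ → V
  mirror a k = op (a ⊕ k)

  mirror-⊕ : ∀ a {k j} → j ≤ k → mirror a k ⊕ j ≡ op (a ⊕ (k ∸ j))
  mirror-⊕ a {k} {j} j≤k = begin
    op (a ⊕ k) ⊕ j                   ≡⟨ cong (λ z → op (a ⊕ z) ⊕ j) (m∸n+n≡m j≤k) ⟨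
    op (a ⊕ (k ∸ j + j)) ⊕ j         ≡⟨ cong (λ z → op z ⊕ j) (⊕-assoc a (k ∸ j) j) ⟨
    op ((a ⊕ (k ∸ j)) ⊕ j) ⊕ j       ≡⟨ op-⊕-⊕ (a ⊕ (k ∸ j)) j ⟩
    op (a ⊕ (k ∸ j))                 ∎
    where open ≡-Reasoning

  mirror-involutive : ∀ a k → mirror (mirror a k) k ≡ a
  mirror-involutive a k = trans (cong op (op-⊕-⊕ a k)) (opposite-involutive a)

  reflect : DecForest → DecForest
  reflect D = record
    { forest = record
      { Star        = λ x y → Spoke D (op x) (op y)
      ; irrefl      = λ s → irrefl (forest D) s ∘ cong op
      ; leaf-no-ctr = leaf-no-ctr (forest D)
      ; uniq-ctr    = λ s s′ → op-injective (uniq-ctr (forest D) s s′)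
      ; noncrossing = λ s s′ → noncrossing (forest D) s s′ ∘ op-cross }
    ; star? = λ x y → star? D (op x) (op y) }

  reflect-edge : ∀ {D x y} → Edge D x y → Edge (reflect D) (op x) (op y)
  reflect-edge {D} {x} {y} = subst₂ (Edge D) (sym (opposite-involutive x)) (sym (opposite-involutive y))

  reflect²-edge : ∀ {D x y} → Edge (reflect (reflect D)) x y → Edge D x y
  reflect²-edge {D} {x} {y} = subst₂ (Edge D) (opposite-involutive x) (opposite-involutive y)

  reflect-supportedIn : ∀ {D} a k → SupportedIn D a k → SupportedIn (reflect D) (mirror a k) k
  reflect-supportedIn {D} a k (e , fan) = mirrored-edge (edge-sym {D} e) , mirrored-fan fan
    where
      a′ : V
      a′ = mirror a k
      mirrored-edge : ∀ {x} → Edge D x a → Edge (reflect D) (op x) (a′ ⊕ k)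
      mirrored-edge {x} e = subst (Edge (reflect D) (op x)) (sym (op-⊕-⊕ a k)) (reflect-edge {D} e)
      reversed : ∀ {j} → 1 ≤ j → j < k → 1 ≤ k ∸ j × k ∸ j < k
      reversed 1≤j j<k = m<n⇒0<n∸m j<k , ∸-monoʳ-< 1≤j (<⇒≤ j<k)
      at : ∀ {j} → 1 ≤ j → j < k → a′ ⊕ j ≡ op (a ⊕ (k ∸ j))
      at 1≤j j<k = mirror-⊕ a (<⇒≤ j<k)
      mirrored-fan : BoundedAll (λ j → Edge D a (a ⊕ j)) k ⊎ BoundedAll (λ j → Edge D (a ⊕ j) (a ⊕ k)) k →
        BoundedAll (λ j → Edge (reflect D) a′ (a′ ⊕ j)) k ⊎ BoundedAll (λ j → Edge (reflect D) (a′ ⊕ j) (a′ ⊕ k)) k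
      mirrored-fan (inj₁ fan) = inj₂ λ j 1≤j j<k → subst (λ z → Edge (reflect D) z (a′ ⊕ k)) (sym (at 1≤j j<k))
        (mirrored-edge (edge-sym {D} (uncurry (fan (k ∸ j)) (reversed 1≤j j<k))))
      mirrored-fan (inj₂ fan) = inj₁ λ j 1≤j j<k → subst (Edge (reflect D) a′) (sym (at 1≤j j<k))
        (edge-sym {reflect D} {op (a ⊕ (k ∸ j))} {a′} (reflect-edge {D} (uncurry (fan (k ∸ j)) (reversed 1≤j j<k))))

module Centred (m : ℕ) (c : Fin (suc m)) (k : ℕ) (k<n : k < suc m) (2≤k : 2 ≤ k) where
  open Cycle m
  open Crossing m
  open Forests m
  open Equivalence

  ρ : V → ℕ
  ρ = offset c

  b : V
  b = c ⊕ k

  ρ-⊕ : ∀ {j} → j < n → ρ (c ⊕ j) ≡ j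
  ρ-⊕ = offset-⊕< c

  ρ-c : ρ c ≡ 0
  ρ-c = offset-self c

  ρ-b : ρ b ≡ k
  ρ-b = ρ-⊕ k<n

  ρ≡0⇒≡c : ∀ {x} → ρ x ≡ 0 → x ≡ c
  ρ≡0⇒≡c = offset≡0⇒≡ c

  c≢b : c ≢ b
  c≢b c≡b = <-irrefl (trans (sym ρ-c) (trans (cong ρ c≡b) ρ-b)) (≤-trans (s≤s z≤n) 2≤k)

  Low : ℕ → V → Set
  Low h x = 0 < ρ x × ρ x ≤ h

  low? : ∀ h x → Dec (Low h x)
  low? h x = (0 <? ρ x) ×-dec (ρ x ≤? h)

  Inner : V → Set
  Inner x = 0 < ρ x × ρ x < k

  inner? : ∀ x → Dec (Inner x)
  inner? x = (0 <? ρ x) ×-dec (ρ x <? k)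

  inner-⊕ : ∀ {j} → 0 < j → j < k → Inner (c ⊕ j)
  inner-⊕ {j} 0<j j<k = subst (0 <_) (sym ρj) 0<j , subst (_< k) (sym ρj) j<k
    where
      ρj : ρ (c ⊕ j) ≡ j
      ρj = ρ-⊕ (<-trans j<k k<n)

  inner⇒≢c : ∀ {x} → Inner x → x ≢ c
  inner⇒≢c (0<ρx , _) refl = <-irrefl (sym ρ-c) 0<ρx

  inner⇒≢b : ∀ {x} → Inner x → x ≢ b
  inner⇒≢b (_ , ρx<k) refl = <-irrefl ρ-b ρx<k

  ¬inner⇒k≤ρ : ∀ {x} → ¬ Inner x → x ≢ c → k ≤ ρ x
  ¬inner⇒k≤ρ {x} ¬inner x≢c = ≮⇒≥ (λ ρx<k → ¬inner (n≢0⇒n>0 (x≢c ∘ ρ≡0⇒≡c) , ρx<k))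

  ¬between-outer : ∀ {a d u} → ¬ Inner a → ¬ Inner d → a ≢ c → d ≢ c → ρ u ≤ k → ¬ Between c a d u
  ¬between-outer ¬ia _ a≢c _ ρu≤k (inj₁ (ρa<ρu , _)) = <⇒≱ (<-≤-trans ρa<ρu ρu≤k) (¬inner⇒k≤ρ ¬ia a≢c)
  ¬between-outer _ ¬id _ d≢c ρu≤k (inj₂ (ρd<ρu , _)) = <⇒≱ (<-≤-trans ρd<ρu ρu≤k) (¬inner⇒k≤ρ ¬id d≢c)

  ¬between-c : ∀ {a d} → ¬ Between c a d c
  ¬between-c {a} (inj₁ (ρa<ρc , _)) = n≮0 (subst (ρ a <_) ρ-c ρa<ρc)
  ¬between-c {d = d} (inj₂ (ρd<ρc , _)) = n≮0 (subst (ρ d <_) ρ-c ρd<ρc)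

  ¬between-fan : ∀ {y u} → ρ y ≤ k → ¬ Inner u → ¬ Between c c y u
  ¬between-fan {u = u} ρy≤k ¬iu (inj₁ (ρc<ρu , ρu<ρy)) = ¬iu (subst (_< ρ u) ρ-c ρc<ρu , <-≤-trans ρu<ρy ρy≤k)
  ¬between-fan {u = u} _ _ (inj₂ (_ , ρu<ρc)) = n≮0 (subst (ρ u <_) ρ-c ρu<ρc)

  inner-outer-cross : ∀ {u w} → Inner u → ¬ Inner w → w ≢ c → w ≢ b → Cross c b u w × Cross c b w u
  inner-outer-cross {u} {w} iu ¬iw w≢c w≢b =
    separates⇒cross c c≢b (≢-sym (inner⇒≢c iu)) (≢-sym w≢c) (≢-sym (inner⇒≢b iu)) (≢-sym w≢b)
      (inj₁ (between-u , ¬between-w)) ,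
    separates⇒cross c c≢b (≢-sym w≢c) (≢-sym (inner⇒≢c iu)) (≢-sym w≢b) (≢-sym (inner⇒≢b iu))
      (inj₂ (¬between-w , between-u))
    where
      between-u : Between c c b u
      between-u = inj₁ (subst (_< ρ u) (sym ρ-c) (proj₁ iu) , subst (ρ u <_) (sym ρ-b) (proj₂ iu))
      ¬between-w : ¬ Between c c b w
      ¬between-w (inj₁ (ρc<ρw , ρw<ρb)) = ¬iw (subst (_< ρ w) ρ-c ρc<ρw , subst (ρ w <_) ρ-b ρw<ρb)
      ¬between-w (inj₂ (_ , ρw<ρc)) = n≮0 (subst (ρ w <_) ρ-c ρw<ρc)

  module FanForest (D : DecForest) (cb : Spoke D c b) where

    FanSpoke : V → V → Set
    FanSpoke x y = (x ≡ c × Low k y) ⊎ (Spoke D x y × ¬ Inner x × ¬ Inner y)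

    fanSpoke? : ∀ x y → Dec (FanSpoke x y)
    fanSpoke? x y = ((x ≟ᶠ c) ×-dec low? k y) ⊎-dec (star? D x y ×-dec ¬? (inner? x) ×-dec ¬? (inner? y))

    low-outer⇒≡b : ∀ {y} → Low k y → ¬ Inner y → y ≡ b
    low-outer⇒≡b {y} (0<ρy , ρy≤k) ¬iy = offset-injective c (trans (≤∧≮⇒≡ ρy≤k (λ ρy<k → ¬iy (0<ρy , ρy<k))) (sym ρ-b))

    fan-irrefl : ∀ {x y} → FanSpoke x y → x ≢ y
    fan-irrefl (inj₁ (refl , 0<ρy , _)) refl = <-irrefl (sym ρ-c) 0<ρy
    fan-irrefl (inj₂ (s , _)) = irrefl (forest D) s

    fan-leaf-no-ctr : ∀ {x v w} → FanSpoke x v → FanSpoke v w → ⊥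
    fan-leaf-no-ctr (inj₁ (refl , 0<ρc , _)) (inj₁ (refl , _)) = <-irrefl (sym ρ-c) 0<ρc
    fan-leaf-no-ctr {w = w} (inj₁ (refl , low)) (inj₂ (s , ¬iv , _)) =
      leaf-no-ctr (forest D) cb (subst (λ z → Spoke D z w) (low-outer⇒≡b low ¬iv) s)
    fan-leaf-no-ctr (inj₂ (s , _)) (inj₁ (refl , _)) = leaf-no-ctr (forest D) s cb
    fan-leaf-no-ctr (inj₂ (s , _)) (inj₂ (s′ , _)) = leaf-no-ctr (forest D) s s′

    fan-uniq-ctr : ∀ {x x′ v} → FanSpoke x v → FanSpoke x′ v → x ≡ x′
    fan-uniq-ctr (inj₁ (refl , _)) (inj₁ (refl , _)) = refl
    fan-uniq-ctr {x′ = x′} (inj₁ (refl , low)) (inj₂ (s , _ , ¬iv)) =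
      uniq-ctr (forest D) cb (subst (Spoke D x′) (low-outer⇒≡b low ¬iv) s)
    fan-uniq-ctr {x = x} (inj₂ (s , _ , ¬iv)) (inj₁ (refl , low)) =
      uniq-ctr (forest D) (subst (Spoke D x) (low-outer⇒≡b low ¬iv) s) cb
    fan-uniq-ctr (inj₂ (s , _)) (inj₂ (s′ , _)) = uniq-ctr (forest D) s s′

    fan-noncrossing : ∀ {a₁ b₁ a₂ b₂} → FanSpoke a₁ b₁ → FanSpoke a₂ b₂ → ¬ Cross a₁ b₁ a₂ b₂
    fan-noncrossing (inj₁ (refl , _)) (inj₁ (refl , _)) (c≢c , _) = c≢c refl
    fan-noncrossing {b₁ = y} {a} {d} (inj₁ (refl , _ , ρy≤k)) (inj₂ (_ , ¬ia , ¬id)) cross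
      with cross⇒separates c cross
    ... | inj₁ (between , _) = ¬between-fan {y} {a} ρy≤k ¬ia between
    ... | inj₂ (_ , between) = ¬between-fan {y} {d} ρy≤k ¬id between
    fan-noncrossing {a} {d} {b₂ = y} (inj₂ (_ , ¬ia , ¬id)) (inj₁ (refl , _ , ρy≤k)) cross@(a≢c , _ , d≢c , _)
      with cross⇒separates c cross
    ... | inj₁ (between , _) = ¬between-c {a} {d} between
    ... | inj₂ (_ , between) = ¬between-outer {a} {d} {y} ¬ia ¬id a≢c d≢c ρy≤k between
    fan-noncrossing (inj₂ (s , _)) (inj₂ (s′ , _)) = noncrossing (forest D) s s′

    fanForest : DecForest
    fanForest = record
      { forest = record
        { Star = FanSpoke ; irrefl = fan-irrefl ; leaf-no-ctr = fan-leaf-no-ctr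
        ; uniq-ctr = fan-uniq-ctr ; noncrossing = fan-noncrossing }
      ; star? = fanSpoke? }

    -- Planarity of D around the spoke c b confines the neighbours of inner vertices.
    inner-neighbour : ∀ {x y} → Edge D x y → Inner x → y ≡ c ⊎ Inner y
    inner-neighbour {x} {y} e ix with inner? y | y ≟ᶠ c | y ≟ᶠ b
    ... | yes iy | _ | _ = inj₂ iy
    ... | no _ | yes y≡c | _ = inj₁ y≡c
    ... | no _ | no _ | yes refl = ⊥-elim (edge-to-b e)
      where
        edge-to-b : ¬ Edge D x b
        edge-to-b (inj₁ s) = inner⇒≢c ix (uniq-ctr (forest D) s cb)
        edge-to-b (inj₂ s) = leaf-no-ctr (forest D) cb s
    ... | no ¬iy | no y≢c | no y≢b = ⊥-elim (crossing e)
      where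
        crossing : ¬ Edge D x y
        crossing (inj₁ s) = noncrossing (forest D) cb s (proj₁ (inner-outer-cross ix ¬iy y≢c y≢b))
        crossing (inj₂ s) = noncrossing (forest D) cb s (proj₂ (inner-outer-cross ix ¬iy y≢c y≢b))

    leaf-of-c : ∀ {x y} → Inner x → Edge D x c → Edge D x y → y ≡ c
    leaf-of-c ix (inj₁ s) _ = ⊥-elim (leaf-no-ctr (forest D) s cb)
    leaf-of-c ix (inj₂ s) e = leaf-neighbour D s e

    fan-edge : ∀ {y} → Low k y → Edge fanForest c y
    fan-edge ly = inj₁ (inj₁ (refl , ly))

    fan-edge-⊕ : ∀ {j} → 1 ≤ j → j ≤ k → Edge fanForest c (c ⊕ j)
    fan-edge-⊕ {j} 1≤j j≤k = fan-edge (subst (0 <_) (sym ρj) 1≤j , subst (_≤ k) (sym ρj) j≤k)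
      where
        ρj : ρ (c ⊕ j) ≡ j
        ρj = ρ-⊕ (≤-<-trans j≤k k<n)

    fan-supports : SupportedIn fanForest c k
    fan-supports = fan-edge-⊕ (≤-trans (s≤s z≤n) 2≤k) ≤-refl , inj₁ (λ j 1≤j j<k → fan-edge-⊕ 1≤j (<⇒≤ j<k))

    outer-edge⇒fan-edge : ∀ {v w} → ¬ Inner v → Edge D v w → Edge fanForest v w
    outer-edge⇒fan-edge {v} {w} ¬iv e with inner? w
    ... | no ¬iw = keep e
      where
        keep : Edge D v w → Edge fanForest v w
        keep (inj₁ s) = inj₁ (inj₂ (s , ¬iv , ¬iw))
        keep (inj₂ s) = inj₂ (inj₂ (s , ¬iw , ¬iv))
    ... | yes iw with inner-neighbour (edge-sym {D} e) iw
    ...   | inj₂ iv = ⊥-elim (¬iv iv)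
    ...   | inj₁ refl = fan-edge (proj₁ iw , <⇒≤ (proj₂ iw))

    inner-edge⇒fan-edge : ∀ {x} → Inner x → Edge D x c → Edge fanForest x c
    inner-edge⇒fan-edge ix _ = edge-sym {fanForest} (fan-edge (proj₁ ix , <⇒≤ (proj₂ ix)))

    no-inner-spokes⇒fan-edge : (∀ {x y} → Spoke D x y → Inner x → Inner y → ⊥) →
                               ∀ {x y} → Edge D x y → Edge fanForest x y
    no-inner-spokes⇒fan-edge none {x} {y} e with inner? x
    ... | no ¬ix = outer-edge⇒fan-edge ¬ix e
    ... | yes ix with inner-neighbour e ix
    ...   | inj₁ refl = inner-edge⇒fan-edge ix e
    ...   | inj₂ iy = ⊥-elim (inner-spoke e)
      where
        inner-spoke : ¬ Edge D x y
        inner-spoke (inj₁ s) = none s ix iy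
        inner-spoke (inj₂ s) = none s iy ix

  InnerWithin : DecForest → ℕ → Set
  InnerWithin D h = ∀ {x y} → Spoke D x y → Inner x → Inner y → ρ x ≤ h × ρ y ≤ h

  between-lows⇒low : ∀ {h x y u} → Low h x → Low h y → Between c x y u → Low h u
  between-lows⇒low (0<ρx , _) (_ , ρy≤h) (inj₁ (ρx<ρu , ρu<ρy)) = ≤-<-trans z≤n ρx<ρu , <⇒≤ (<-≤-trans ρu<ρy ρy≤h)
  between-lows⇒low (_ , ρx≤h) (0<ρy , _) (inj₂ (ρy<ρu , ρu<ρx)) = ≤-<-trans z≤n ρy<ρu , <⇒≤ (<-≤-trans ρu<ρx ρx≤h)

  ¬low⇒c∨beyond : ∀ {h u} → ¬ Low h u → ρ u ≡ 0 ⊎ h < ρ u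
  ¬low⇒c∨beyond {h} {u} ¬low with 0 <? ρ u
  ... | no ¬0<ρu = inj₁ (n≤0⇒n≡0 (≮⇒≥ ¬0<ρu))
  ... | yes 0<ρu = inj₂ (≰⇒> (λ ρu≤h → ¬low (0<ρu , ρu≤h)))

  Straddles : ℕ → V → V → Set
  Straddles h u w = (ρ u ≡ 0 × h < ρ w) ⊎ (ρ w ≡ 0 × h < ρ u)

  between-nonlows⇔straddles : ∀ {h u w z} → ¬ Low h u → ¬ Low h w → Low h z → Between c u w z ⇔ Straddles h u w
  between-nonlows⇔straddles {h} {u} {w} {z} ¬lu ¬lw (0<ρz , ρz≤h) = mk⇔ forth back
    where
      forth : Between c u w z → Straddles h u w
      forth (inj₁ (ρu<ρz , ρz<ρw)) with ¬low⇒c∨beyond {h} {u} ¬lu | ¬low⇒c∨beyond {h} {w} ¬lw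
      ... | inj₂ h<ρu | _ = ⊥-elim (<-asym (<-≤-trans ρu<ρz ρz≤h) h<ρu)
      ... | inj₁ ρu≡0 | inj₂ h<ρw = inj₁ (ρu≡0 , h<ρw)
      ... | inj₁ _ | inj₁ ρw≡0 = ⊥-elim (n≮0 (subst (ρ z <_) ρw≡0 ρz<ρw))
      forth (inj₂ (ρw<ρz , ρz<ρu)) with ¬low⇒c∨beyond {h} {u} ¬lu | ¬low⇒c∨beyond {h} {w} ¬lw
      ... | _ | inj₂ h<ρw = ⊥-elim (<-asym (<-≤-trans ρw<ρz ρz≤h) h<ρw)
      ... | inj₂ h<ρu | inj₁ ρw≡0 = inj₂ (ρw≡0 , h<ρu)
      ... | inj₁ ρu≡0 | inj₁ _ = ⊥-elim (n≮0 (subst (ρ z <_) ρu≡0 ρz<ρu))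
      back : Straddles h u w → Between c u w z
      back (inj₁ (ρu≡0 , h<ρw)) = inj₁ (subst (_< ρ z) (sym ρu≡0) 0<ρz , ≤-<-trans ρz≤h h<ρw)
      back (inj₂ (ρw≡0 , h<ρu)) = inj₂ (subst (_< ρ z) (sym ρw≡0) 0<ρz , ≤-<-trans ρz≤h h<ρu)

  -- The inner spokes of Di lie among the vertices at distance 1 … h from c, which the spokes kept from Dm avoid.
  module MergeForest (Di Dm : DecForest) (h : ℕ) (within : InnerWithin Di h) where

    MergeSpoke : V → V → Set
    MergeSpoke x y = (Spoke Di x y × Inner x × Inner y) ⊎ (Spoke Dm x y × ¬ Low h x × ¬ Low h y)

    mergeSpoke? : ∀ x y → Dec (MergeSpoke x y)
    mergeSpoke? x y = (star? Di x y ×-dec inner? x ×-dec inner? y) ⊎-dec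
                      (star? Dm x y ×-dec ¬? (low? h x) ×-dec ¬? (low? h y))

    low-centre : ∀ {x y} → Spoke Di x y → Inner x → Inner y → Low h x
    low-centre s ix iy = proj₁ ix , proj₁ (within s ix iy)

    low-leaf : ∀ {x y} → Spoke Di x y → Inner x → Inner y → Low h y
    low-leaf s ix iy = proj₁ iy , proj₂ (within s ix iy)

    merge-irrefl : ∀ {x y} → MergeSpoke x y → x ≢ y
    merge-irrefl (inj₁ (s , _)) = irrefl (forest Di) s
    merge-irrefl (inj₂ (s , _)) = irrefl (forest Dm) s

    merge-leaf-no-ctr : ∀ {x v w} → MergeSpoke x v → MergeSpoke v w → ⊥
    merge-leaf-no-ctr (inj₁ (s , _)) (inj₁ (s′ , _)) = leaf-no-ctr (forest Di) s s′
    merge-leaf-no-ctr (inj₁ (s , ix , iv)) (inj₂ (_ , ¬lv , _)) = ¬lv (low-leaf s ix iv)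
    merge-leaf-no-ctr (inj₂ (_ , _ , ¬lv)) (inj₁ (s , iv , iw)) = ¬lv (low-centre s iv iw)
    merge-leaf-no-ctr (inj₂ (s , _)) (inj₂ (s′ , _)) = leaf-no-ctr (forest Dm) s s′

    merge-uniq-ctr : ∀ {x x′ v} → MergeSpoke x v → MergeSpoke x′ v → x ≡ x′
    merge-uniq-ctr (inj₁ (s , _)) (inj₁ (s′ , _)) = uniq-ctr (forest Di) s s′
    merge-uniq-ctr (inj₁ (s , ix , iv)) (inj₂ (_ , _ , ¬lv)) = ⊥-elim (¬lv (low-leaf s ix iv))
    merge-uniq-ctr (inj₂ (_ , _ , ¬lv)) (inj₁ (s , ix , iv)) = ⊥-elim (¬lv (low-leaf s ix iv))
    merge-uniq-ctr (inj₂ (s , _)) (inj₂ (s′ , _)) = uniq-ctr (forest Dm) s s′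

    merge-noncrossing : ∀ {a₁ b₁ a₂ b₂} → MergeSpoke a₁ b₁ → MergeSpoke a₂ b₂ → ¬ Cross a₁ b₁ a₂ b₂
    merge-noncrossing (inj₁ (s , _)) (inj₁ (s′ , _)) = noncrossing (forest Di) s s′
    merge-noncrossing (inj₂ (s , _)) (inj₂ (s′ , _)) = noncrossing (forest Dm) s s′
    merge-noncrossing {x} {y} {u} {w} (inj₁ (s , ix , iy)) (inj₂ (_ , ¬lu , ¬lw)) cross
      with cross⇒separates c cross
    ... | inj₁ (between , _) = ¬lu (between-lows⇒low {h} {x} {y} {u} (low-centre s ix iy) (low-leaf s ix iy) between)
    ... | inj₂ (_ , between) = ¬lw (between-lows⇒low {h} {x} {y} {w} (low-centre s ix iy) (low-leaf s ix iy) between)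
    merge-noncrossing {u} {w} {x} {y} (inj₂ (_ , ¬lu , ¬lw)) (inj₁ (s , ix , iy)) cross =
      both-or-neither (cross⇒separates c cross)
      where
        via : ∀ z → Low h z → Between c u w z ⇔ Straddles h u w
        via z = between-nonlows⇔straddles {h} {u} {w} {z} ¬lu ¬lw
        both-or-neither : ¬ Separates (Between c u w x) (Between c u w y)
        both-or-neither (inj₁ (bx , ¬by)) = ¬by (from (via y (low-leaf s ix iy)) (to (via x (low-centre s ix iy)) bx))
        both-or-neither (inj₂ (¬bx , by)) = ¬bx (from (via x (low-centre s ix iy)) (to (via y (low-leaf s ix iy)) by))

    mergeForest : DecForest
    mergeForest = record
      { forest = record
        { Star = MergeSpoke ; irrefl = merge-irrefl ; leaf-no-ctr = merge-leaf-no-ctr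
        ; uniq-ctr = merge-uniq-ctr ; noncrossing = merge-noncrossing }
      ; star? = mergeSpoke? }

    merge-inner-edge : ∀ {v w} → Inner v → Inner w → Edge Di v w → Edge mergeForest v w
    merge-inner-edge iv iw (inj₁ s) = inj₁ (inj₁ (s , iv , iw))
    merge-inner-edge iv iw (inj₂ s) = inj₂ (inj₁ (s , iw , iv))

    merge-far-edge : ∀ {v w} → ¬ Low h v → ¬ Low h w → Edge Dm v w → Edge mergeForest v w
    merge-far-edge ¬lv ¬lw (inj₁ s) = inj₁ (inj₂ (s , ¬lv , ¬lw))
    merge-far-edge ¬lv ¬lw (inj₂ s) = inj₂ (inj₂ (s , ¬lw , ¬lv))

  adjacent-to-all⇒supportedIn : ∀ {D} → (∀ {x} → x ≢ c → Edge D c x) → SupportedIn D c k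
  adjacent-to-all⇒supportedIn adjacent = adjacent (c≢c⊕ (≤-trans (s≤s z≤n) 2≤k) k<n) ,
    inj₁ (λ j 1≤j j<k → adjacent (c≢c⊕ 1≤j (<-trans j<k k<n)))
    where
      c≢c⊕ : ∀ {j} → 1 ≤ j → j < n → c ⊕ j ≢ c
      c≢c⊕ 1≤j j<n eq = <-irrefl (sym (trans (sym (ρ-⊕ j<n)) (trans (cong ρ eq) ρ-c))) 1≤j

  module BeforeCentre (a : V) (k′ : ℕ) (k′<n : k′ < n) (a⊕k′≡c : a ⊕ k′ ≡ c) where

    ⊕-before : ∀ j → a ⊕ j ≡ c ⊕ (n ∸ k′ + j)
    ⊕-before j = begin
      a ⊕ j                      ≡⟨ cong (_⊕ j) (⊕-period a) ⟨
      (a ⊕ n) ⊕ j                ≡⟨ ⊕-assoc a n j ⟩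
      a ⊕ (n + j)                ≡⟨ cong (λ z → a ⊕ (z + j)) (m+[n∸m]≡n (<⇒≤ k′<n)) ⟨
      a ⊕ (k′ + (n ∸ k′) + j)    ≡⟨ cong (a ⊕_) (+-assoc k′ (n ∸ k′) j) ⟩
      a ⊕ (k′ + (n ∸ k′ + j))    ≡⟨ ⊕-assoc a k′ (n ∸ k′ + j) ⟨
      (a ⊕ k′) ⊕ (n ∸ k′ + j)    ≡⟨ cong (_⊕ (n ∸ k′ + j)) a⊕k′≡c ⟩
      c ⊕ (n ∸ k′ + j)           ∎
      where open ≡-Reasoning

    ρ-before : ∀ {j} → j < k′ → ρ (a ⊕ j) ≡ n ∸ k′ + j
    ρ-before {j} j<k′ = trans (cong ρ (⊕-before j))
      (ρ-⊕ (subst (n ∸ k′ + j <_) (m∸n+n≡m (<⇒≤ k′<n)) (+-monoʳ-< (n ∸ k′) j<k′)))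

    beyond⇒before : ∀ {x} → n ∸ k′ ≤ ρ x → Σ ℕ λ j → j < k′ × a ⊕ j ≡ x
    beyond⇒before {x} n∸k′≤ρx = ρ x ∸ (n ∸ k′) ,
      subst (ρ x ∸ (n ∸ k′) <_) (m∸[m∸n]≡n (<⇒≤ k′<n)) (∸-monoˡ-< (offset<n c x) n∸k′≤ρx) ,
      trans (⊕-before _) (trans (cong (c ⊕_) (m+[n∸m]≡n n∸k′≤ρx)) (⊕-offset c x))

  ρ-⊕-nowrap : ∀ a {l} → l < n → ρ a ≤ ρ (a ⊕ l) → ρ (a ⊕ l) ≡ ρ a + l
  ρ-⊕-nowrap a {l} l<n ρa≤ with offsetSum c a (a ⊕ l)
  ... | noWrap _ eq = trans (sym eq) (cong (ρ a +_) (offset-⊕< a l<n))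
  ... | wrap ρ<ρa _ = ⊥-elim (<⇒≱ ρ<ρa ρa≤)

  ρ-⊕-small : ∀ a {l} → ρ a + l < n → ρ (a ⊕ l) ≡ ρ a + l
  ρ-⊕-small a {l} lt = trans (offset-shift c a l) (m<n⇒m%n≡m lt)

  ρ≤1+h⇒ρ≤h : ∀ {u h} → suc h < n → u ≢ c ⊕ suc h → ρ u ≤ suc h → ρ u ≤ h
  ρ≤1+h⇒ρ≤h 1+h<n u≢ ρu≤ = ≤-pred (≤∧≢⇒< ρu≤ (λ ρu≡ → u≢ (offset-injective c (trans ρu≡ (sym (ρ-⊕ 1+h<n))))))

  within-pred : ∀ {D h} → suc h < n → (∀ {y} → Edge D (c ⊕ suc h) y → ¬ Inner y) →
                InnerWithin D (suc h) → InnerWithin D h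
  within-pred {D} {h} 1+h<n isolated within {x} {y} s ix iy =
    ρ≤1+h⇒ρ≤h {x} 1+h<n (λ { refl → isolated (inj₁ s) iy }) (proj₁ (within s ix iy)) ,
    ρ≤1+h⇒ρ≤h {y} 1+h<n (λ { refl → isolated (inj₂ s) ix }) (proj₂ (within s ix iy))

module Repair (m : ℕ) (c : Fin (suc m)) (k : ℕ) (k<n : k < suc m) (2≤k : 2 ≤ k) {t : ℕ} (i : Fin t) where
  open Cycle m
  open Forests m
  open Centred m c k k<n 2≤k

  module Fill (Fs : Family t) (cov : Covers Fs) (cb : Spoke (Fs i) c b)
              (none : ∀ {x y} → Spoke (Fs i) x y → Inner x → Inner y → ⊥) where
    open FanForest (Fs i) cb

    filled : Family t
    filled = Fs [ i ≔ fanForest ]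

    fill-edge : ∀ p {x y} → Edge (Fs p) x y → ∃[ q ] Edge (filled q) x y
    fill-edge p e with p ≟ᶠ i
    ... | yes refl = edge-in filled i (≔-here Fs i fanForest) (no-inner-spokes⇒fan-edge none e)
    ... | no p≢i   = edge-in filled p (≔-there Fs fanForest p≢i) e

    fill-support : ∀ {a k′} p → SupportedIn (Fs p) a k′ → SupportedBy filled a k′
    fill-support p s with p ≟ᶠ i
    ... | yes refl = supportedIn-in filled i (≔-here Fs i fanForest) (supportedIn-map {Fs i} {fanForest} (no-inner-spokes⇒fan-edge none) s)
    ... | no p≢i   = supportedIn-in filled p (≔-there Fs fanForest p≢i) s

    fill : Repaired k c Fs
    fill = filled , covers-redistribute Fs filled cov fill-edge ,
           (λ k′ a _ _ → supportedBy-redistribute Fs filled {a} {k′} (fill-support {a} {k′})) ,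
           supportedIn-in filled i (≔-here Fs i fanForest) fan-supports

  -- By induction on k, the h-edge at c is supported; here Fs mm has the fan c (c ⊕ 1), …, c (c ⊕ h).
  module Swap (Fs : Family t) (cov : Covers Fs) (cb : Spoke (Fs i) c b) (¬sup : ¬ SupportedBy Fs c k)
              (h : ℕ) (2≤h : 2 ≤ h) (h<k : h < k) (within : InnerWithin (Fs i) h)
              (mm : Fin t) (mm≢i : mm ≢ i)
              (main : Edge (Fs mm) c (c ⊕ h)) (fan : BoundedAll (λ j → Edge (Fs mm) c (c ⊕ j)) h) where
    Di : DecForest
    Di = Fs i
    Dm : DecForest
    Dm = Fs mm
    open FanForest Di cb
    open MergeForest Di Dm h within

    h<n : h < n
    h<n = <-trans h<k k<n

    low-edge : ∀ {z} → Low h z → Edge Dm c z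
    low-edge {z} (0<ρz , ρz≤h) with ρ z ≟ h
    ... | yes ρz≡h = subst (Edge Dm c) (⊕-offset c z) (subst (λ j → Edge Dm c (c ⊕ j)) (sym ρz≡h) main)
    ... | no ρz≢h  = subst (Edge Dm c) (⊕-offset c z) (fan (ρ z) 0<ρz (≤∧≢⇒< ρz≤h ρz≢h))

    c-centre : Spoke Dm c (c ⊕ 1)
    c-centre = two-neighbours⇒centre Dm (fan 1 ≤-refl 2≤h) main (a⊕1≢a⊕k {Dm} {c} {h} 2≤h h<n main)

    low-spoke : ∀ {z} → Low h z → Spoke Dm c z
    low-spoke lz with low-edge lz
    ... | inj₁ s = s
    ... | inj₂ s = ⊥-elim (leaf-no-ctr (forest Dm) s c-centre)

    low-neighbour : ∀ {z y} → Low h z → Edge Dm z y → y ≡ c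
    low-neighbour lz = leaf-neighbour Dm (low-spoke lz)

    fan-low : ∀ {z} → Low h z → Edge fanForest c z
    fan-low (0<ρz , ρz≤h) = fan-edge (0<ρz , ≤-trans ρz≤h (<⇒≤ h<k))

    Di-moves : ∀ {x y} → Edge Di x y → Edge fanForest x y ⊎ Edge mergeForest x y
    Di-moves {x} e with inner? x
    ... | no ¬ix = inj₁ (outer-edge⇒fan-edge ¬ix e)
    ... | yes ix with inner-neighbour e ix
    ...   | inj₁ refl = inj₁ (inner-edge⇒fan-edge ix e)
    ...   | inj₂ iy   = inj₂ (merge-inner-edge ix iy e)

    Dm-moves : ∀ {x y} → Edge Dm x y → Edge fanForest x y ⊎ Edge mergeForest x y
    Dm-moves {x} {y} e with low? h x | low? h y
    ... | yes lx | _ with low-neighbour lx e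
    ...   | refl = inj₁ (edge-sym {fanForest} (fan-low lx))
    Dm-moves e | no _ | yes ly with low-neighbour ly (edge-sym {Dm} e)
    ...   | refl = inj₁ (fan-low ly)
    Dm-moves e | no ¬lx | no ¬ly = inj₂ (merge-far-edge ¬lx ¬ly e)

    -- An inner vertex with two neighbours is not adjacent to c, so it keeps all its edges in the merge.
    Di-split : ∀ v → TwoNeighbours Di v → Di ⊆ fanForest at v ⊎ Di ⊆ mergeForest at v
    Di-split v (w₁ , w₂ , w₁≢w₂ , e₁ , e₂) with inner? v
    ... | no ¬iv = inj₁ (outer-edge⇒fan-edge ¬iv)
    ... | yes iv = inj₂ λ e → merge-inner-edge iv (inner-neighbours e) e
      where
        inner-neighbours : ∀ {w} → Edge Di v w → Inner w
        inner-neighbours e with inner-neighbour e iv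
        ... | inj₂ iw = iw
        ... | inj₁ refl = ⊥-elim (w₁≢w₂ (trans (leaf-of-c iv e e₁) (sym (leaf-of-c iv e e₂))))

    Dm-apex : ∀ v → TwoNeighbours Dm v → v ≢ c → Dm ⊆ mergeForest at v
    Dm-apex v (w₁ , w₂ , w₁≢w₂ , e₁ , e₂) v≢c with low? h v
    ... | yes lv = ⊥-elim (w₁≢w₂ (trans (low-neighbour lv e₁) (sym (low-neighbour lv e₂))))
    ... | no ¬lv = λ e → merge-far-edge ¬lv (λ lw → v≢c (low-neighbour lw (edge-sym {Dm} e))) e

    -- The inward fan at c = a ⊕ k′ reaches the distances n - k′, …, n - 1 from c; if these meet 1, …, h,
    -- then c is adjacent in Dm to every vertex.
    module Wrapped {a k′} (2≤k′ : 2 ≤ k′) (k′<n : k′ < n) (a⊕k′≡c : a ⊕ k′ ≡ c)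
                   (e : Edge Dm a (a ⊕ k′)) (fan′ : BoundedAll (λ j → Edge Dm (a ⊕ j) (a ⊕ k′)) k′) where
      open BeforeCentre a k′ k′<n a⊕k′≡c

      ¬low-c : ¬ Low h (a ⊕ k′)
      ¬low-c (0<ρ , _) = <-irrefl (sym (trans (cong ρ a⊕k′≡c) ρ-c)) 0<ρ

      far : h < n ∸ k′ → SupportedIn mergeForest a k′
      far h<n∸k′ = merge-far-edge (subst (¬_ ∘ Low h) (⊕-identityʳ a) (¬low-before (≤-<-trans z≤n 2≤k′))) ¬low-c e ,
                   inj₂ λ j 1≤j j<k′ → merge-far-edge (¬low-before j<k′) ¬low-c (fan′ j 1≤j j<k′)
        where
          ¬low-before : ∀ {j} → j < k′ → ¬ Low h (a ⊕ j)
          ¬low-before {j} j<k′ (_ , ρ≤h) =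
            <⇒≱ (<-≤-trans h<n∸k′ (subst (n ∸ k′ ≤_) (sym (ρ-before j<k′)) (m≤m+n (n ∸ k′) j))) ρ≤h

      near : n ∸ k′ ≤ h → SupportedIn Dm c k
      near n∸k′≤h = adjacent-to-all⇒supportedIn {Dm} adjacent
        where
          adjacent : ∀ {x} → x ≢ c → Edge Dm c x
          adjacent {x} x≢c with low? h x
          ... | yes lx = low-edge lx
          ... | no ¬lx with beyond⇒before (≤-trans n∸k′≤h (<⇒≤ h<ρx))
            where
              h<ρx : h < ρ x
              h<ρx = ≰⇒> λ ρx≤h → ¬lx (n≢0⇒n>0 (x≢c ∘ ρ≡0⇒≡c) , ρx≤h)
          ...   | j , j<k′ , a⊕j≡x = subst₂ (Edge Dm) a⊕k′≡c a⊕j≡x (edge-sym {Dm} (inward-edges {Dm} e fan′ j j<k′))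

    Dm-support-moves : ∀ {a k′} → 2 ≤ k′ → k′ ≤ k → SupportedIn Dm a k′ →
                       SupportedIn fanForest a k′ ⊎ SupportedIn mergeForest a k′
    Dm-support-moves {a} {k′} 2≤k′ k′≤k (e , inj₁ fan′) with a ≟ᶠ c
    ... | yes refl = inj₁ (fan-edge-⊕ (<⇒≤ 2≤k′) k′≤k ,
                           inj₁ (λ j 1≤j j<k′ → fan-edge-⊕ 1≤j (≤-trans (<⇒≤ j<k′) k′≤k)))
    ... | no a≢c = inj₂ (outward-moves {Dm} {mergeForest} {a} {k′} e fan′
                          (Dm-apex a (outward-apex {Dm} {a} {k′} 2≤k′ (≤-<-trans k′≤k k<n) e fan′) a≢c))
    Dm-support-moves {a} {k′} 2≤k′ k′≤k (e , inj₂ fan′) with (a ⊕ k′) ≟ᶠ c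
    ... | no a⊕k′≢c = inj₂ (inward-moves {Dm} {mergeForest} {a} {k′} e fan′
                             (Dm-apex (a ⊕ k′) (inward-apex {Dm} {a} {k′} 2≤k′ (≤-<-trans k′≤k k<n) e fan′) a⊕k′≢c))
    ... | yes a⊕k′≡c with h <? n ∸ k′
    ...   | yes h<n∸k′ = inj₂ (Wrapped.far 2≤k′ (≤-<-trans k′≤k k<n) a⊕k′≡c e fan′ h<n∸k′)
    ...   | no h≮n∸k′  = ⊥-elim (¬sup (mm , Wrapped.near 2≤k′ (≤-<-trans k′≤k k<n) a⊕k′≡c e fan′ (≮⇒≥ h≮n∸k′)))

    swapped : Family t
    swapped = (Fs [ i ≔ fanForest ]) [ mm ≔ mergeForest ]

    swapped-i : swapped i ≡ fanForest
    swapped-i = trans (≔-there (Fs [ i ≔ fanForest ]) mergeForest (mm≢i ∘ sym)) (≔-here Fs i fanForest)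

    swapped-mm : swapped mm ≡ mergeForest
    swapped-mm = ≔-here (Fs [ i ≔ fanForest ]) mm mergeForest

    swapped-other : ∀ {p} → p ≢ i → p ≢ mm → swapped p ≡ Fs p
    swapped-other p≢i p≢mm = trans (≔-there (Fs [ i ≔ fanForest ]) mergeForest p≢mm) (≔-there Fs fanForest p≢i)

    swapped-edge : ∀ p {x y} → Edge (Fs p) x y → ∃[ q ] Edge (swapped q) x y
    swapped-edge p e with p ≟ᶠ i | p ≟ᶠ mm
    ... | yes refl | _ = [ edge-in swapped i swapped-i , edge-in swapped mm swapped-mm ] (Di-moves e)
    ... | no _ | yes refl = [ edge-in swapped i swapped-i , edge-in swapped mm swapped-mm ] (Dm-moves e)
    ... | no p≢i | no p≢mm = edge-in swapped p (swapped-other p≢i p≢mm) e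

    swapped-support : ∀ {a k′} → 2 ≤ k′ → k′ ≤ k → ∀ p → SupportedIn (Fs p) a k′ → SupportedBy swapped a k′
    swapped-support {a} {k′} 2≤k′ k′≤k p s with p ≟ᶠ i | p ≟ᶠ mm
    ... | yes refl | _ = [ supportedIn-in swapped i swapped-i , supportedIn-in swapped mm swapped-mm ]
                           (supportedIn-split {Di} {fanForest} {mergeForest} {a} {k′} 2≤k′ (≤-<-trans k′≤k k<n) s Di-split)
    ... | no _ | yes refl = [ supportedIn-in swapped i swapped-i , supportedIn-in swapped mm swapped-mm ]
                              (Dm-support-moves 2≤k′ k′≤k s)
    ... | no p≢i | no p≢mm = supportedIn-in swapped p (swapped-other p≢i p≢mm) s

    swap : Repaired k c Fs
    swap = swapped , covers-redistribute Fs swapped cov swapped-edge ,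
           (λ k′ a 2≤k′ k′≤k → supportedBy-redistribute Fs swapped {a} {k′} (swapped-support 2≤k′ k′≤k)) ,
           supportedIn-in swapped i swapped-i fan-supports

  Shrunk : Family t → ℕ → Set₁
  Shrunk Fs h = Σ (Family t) λ Fs′ → Covers Fs′ × Preserves k Fs Fs′ × ¬ SupportedBy Fs′ c k ×
                                 Spoke (Fs′ i) c b × InnerWithin (Fs′ i) h

  -- Fs mm contains the fan c q, (c ⊕ 1) q, …, (c ⊕ h) q supporting the (1 + h)-edge at c,
  -- and q = c ⊕ (1 + h) has an inner neighbour y in Fs i.
  module Remove (Fs : Family t) (cov : Covers Fs) (cb : Spoke (Fs i) c b) (¬sup : ¬ SupportedBy Fs c k)
                (h : ℕ) (h<k : suc h < k) (within : InnerWithin (Fs i) (suc h))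
                (mm : Fin t) (mm≢i : mm ≢ i)
                (main : Edge (Fs mm) c (c ⊕ suc h)) (fan : BoundedAll (λ j → Edge (Fs mm) (c ⊕ j) (c ⊕ suc h)) (suc h))
                (y : V) (qy : Edge (Fs i) (c ⊕ suc h) y) (iy : Inner y) where
    Di : DecForest
    Di = Fs i
    Dm : DecForest
    Dm = Fs mm
    open FanForest Di cb

    q : V
    q = c ⊕ suc h

    ρ-q : ρ q ≡ suc h
    ρ-q = ρ-⊕ (<-trans h<k k<n)

    inner-q : Inner q
    inner-q = inner-⊕ (s≤s z≤n) h<k

    within-at : ∀ {u w} → Inner u → Inner w → Edge Di u w → ρ w ≤ suc h
    within-at iu iw (inj₁ s) = proj₂ (within s iu iw)
    within-at iu iw (inj₂ s) = proj₁ (within s iw iu)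

    -- q has the neighbour y ≠ c, hence is not a leaf of c.
    q-neighbour : ∀ {w} → Edge Di q w → Inner w × ρ w < suc h
    q-neighbour {w} e with inner-neighbour e inner-q
    ... | inj₁ refl = ⊥-elim (inner⇒≢c iy (leaf-of-c inner-q e qy))
    ... | inj₂ iw = iw , ≤∧≢⇒< (within-at inner-q iw e)
                                (λ ρw≡ → edge⇒≢ {Di} e (sym (offset-injective c (trans ρw≡ (sym ρ-q)))))

    ¬far-neighbour : ∀ u {w} → Inner u → Edge Di u w → ρ w ≡ suc (suc h) → ⊥
    ¬far-neighbour u iu e ρw≡ with inner-neighbour e iu
    ... | inj₁ refl = 0≢1+n (trans (sym ρ-c) ρw≡)
    ... | inj₂ iw = <-irrefl refl (subst (_≤ suc h) ρw≡ (within-at iu iw e))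

    ρ-after-q : ∀ x j → x ⊕ j ≡ q → ρ (x ⊕ suc j) ≡ suc (suc h)
    ρ-after-q x j x⊕j≡q = begin
      ρ (x ⊕ suc j)        ≡⟨ cong (λ z → ρ (x ⊕ z)) (+-comm 1 j) ⟩
      ρ (x ⊕ (j + 1))      ≡⟨ cong ρ (⊕-assoc x j 1) ⟨
      ρ ((x ⊕ j) ⊕ 1)      ≡⟨ cong (λ z → ρ (z ⊕ 1)) x⊕j≡q ⟩
      ρ (q ⊕ 1)            ≡⟨ cong ρ (⊕-assoc c (suc h) 1) ⟩
      ρ (c ⊕ (suc h + 1))  ≡⟨ ρ-⊕ (subst (_< n) (+-comm 1 (suc h)) (≤-<-trans h<k k<n)) ⟩
      suc h + 1            ≡⟨ +-comm (suc h) 1 ⟩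
      suc (suc h)          ∎
      where open ≡-Reasoning

    to-Dm : ∀ {w} → Inner w → ρ w < suc h → Edge Dm w q
    to-Dm {w} iw ρw<1+h = subst (λ z → Edge Dm z q) (⊕-offset c w) (fan (ρ w) (proj₁ iw) ρw<1+h)

    pruned : DecForest
    pruned = without Di q

    prune : ∀ {x z} → Edge Di x z → x ≢ q → z ≢ q → Edge pruned x z
    prune (inj₁ s) x≢q z≢q = inj₁ (s , x≢q , z≢q)
    prune (inj₂ s) x≢q z≢q = inj₂ (s , z≢q , x≢q)

    unprune : ∀ {x z} → Edge pruned x z → Edge Di x z
    unprune (inj₁ (s , _)) = inj₁ s
    unprune (inj₂ (s , _)) = inj₂ s

    ¬ρ-after-q : ∀ x j → x ⊕ j ≡ q → ρ (x ⊕ suc j) < suc h → ⊥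
    ¬ρ-after-q x j eq lt = <⇒≱ lt (≤-trans (n≤1+n (suc h)) (≤-reflexive (sym (ρ-after-q x j eq))))

    -- A k′-edge ending at q lies between vertices inner and below q, where Dm has all edges to q.
    ending-at-q : ∀ {a k′} → 0 < k′ → k′ < n → a ⊕ k′ ≡ q → Edge Di a (a ⊕ k′) → SupportedIn Dm a k′
    ending-at-q {a} {k′} 0<k′ k′<n a⊕k′≡q e =
      inward-support {Dm} {a} {k′} 0<k′ λ {j} j<k′ → subst (Edge Dm (a ⊕ j)) (sym a⊕k′≡q) (uncurry to-Dm (before-q j<k′))
      where
        a-near : Inner a × ρ a < suc h
        a-near = q-neighbour (edge-sym {Di} (subst (Edge Di a) a⊕k′≡q e))
        ρ-q≡ : ρ q ≡ ρ a + k′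
        ρ-q≡ = trans (cong ρ (sym a⊕k′≡q))
                 (ρ-⊕-nowrap a k′<n (subst (ρ a ≤_) (trans (sym ρ-q) (cong ρ (sym a⊕k′≡q))) (<⇒≤ (proj₂ a-near))))
        before-q : ∀ {j} → j < k′ → Inner (a ⊕ j) × ρ (a ⊕ j) < suc h
        before-q {j} j<k′ = (subst (0 <_) (sym ρ-aj) (<-≤-trans (proj₁ (proj₁ a-near)) (m≤m+n (ρ a) j)) ,
                             subst (_< k) (sym ρ-aj) (<-trans lt h<k)) , subst (_< suc h) (sym ρ-aj) lt
          where
            lt : ρ a + j < suc h
            lt = subst (ρ a + j <_) (trans (sym ρ-q≡) ρ-q) (+-monoʳ-< (ρ a) j<k′)
            ρ-aj : ρ (a ⊕ j) ≡ ρ a + j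
            ρ-aj = ρ-⊕-small a (<-trans lt (<-trans h<k k<n))

    outward : ∀ {a k′} → 2 ≤ k′ → k′ < n → Edge Di a (a ⊕ k′) → BoundedAll (λ j → Edge Di a (a ⊕ j)) k′ →
              SupportedIn pruned a k′ ⊎ SupportedIn Dm a k′
    outward {a} {k′} 2≤k′ k′<n e fan′ with a ≟ᶠ q | (a ⊕ k′) ≟ᶠ q
    ... | _ | yes a⊕k′≡q = inj₂ (ending-at-q (≤-<-trans z≤n 2≤k′) k′<n a⊕k′≡q e)
    ... | yes refl | no _ = ⊥-elim (¬ρ-after-q q 0 (⊕-identityʳ q) (proj₂ (q-neighbour (fan′ 1 ≤-refl 2≤k′))))
    ... | no a≢q | no a⊕k′≢q =
      inj₁ (prune e a≢q a⊕k′≢q , inj₁ λ j 1≤j j<k′ → prune (fan′ j 1≤j j<k′) a≢q (avoid 1≤j j<k′))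
      where
        avoid : ∀ {j} → 1 ≤ j → j < k′ → a ⊕ j ≢ q
        avoid {j} 1≤j j<k′ a⊕j≡q = ¬far-neighbour a inner-a next (ρ-after-q a j a⊕j≡q)
          where
            inner-a : Inner a
            inner-a = proj₁ (q-neighbour (edge-sym {Di} (subst (Edge Di a) a⊕j≡q (fan′ j 1≤j j<k′))))
            next : Edge Di a (a ⊕ suc j)
            next with m≤n⇒m<n∨m≡n j<k′
            ... | inj₁ 1+j<k′ = fan′ (suc j) (s≤s z≤n) 1+j<k′
            ... | inj₂ 1+j≡k′ = subst (λ z → Edge Di a (a ⊕ z)) (sym 1+j≡k′) e

    inward : ∀ {a k′} → 2 ≤ k′ → k′ < n → Edge Di a (a ⊕ k′) → BoundedAll (λ j → Edge Di (a ⊕ j) (a ⊕ k′)) k′ →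
             SupportedIn pruned a k′ ⊎ SupportedIn Dm a k′
    inward {a} {k′} 2≤k′ k′<n e fan′ with (a ⊕ k′) ≟ᶠ q
    ... | yes a⊕k′≡q = inj₂ (ending-at-q (≤-<-trans z≤n 2≤k′) k′<n a⊕k′≡q e)
    ... | no a⊕k′≢q = inj₁ (inward-support {pruned} {a} {k′} (≤-<-trans z≤n 2≤k′)
                              λ j<k′ → prune (inward-edges {Di} e fan′ _ j<k′) (avoid j<k′) a⊕k′≢q)
      where
        avoid : ∀ {j} → j < k′ → a ⊕ j ≢ q
        avoid {j} j<k′ a⊕j≡q with m≤n⇒m<n∨m≡n j<k′
        ... | inj₁ 1+j<k′ =
          ¬far-neighbour (a ⊕ k′) inner-end (edge-sym {Di} (fan′ (suc j) (s≤s z≤n) 1+j<k′)) (ρ-after-q a j a⊕j≡q)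
          where
            inner-end : Inner (a ⊕ k′)
            inner-end = proj₁ (q-neighbour (subst (λ z → Edge Di z (a ⊕ k′)) a⊕j≡q (inward-edges {Di} e fan′ j j<k′)))
        ... | inj₂ 1+j≡k′ = ¬ρ-after-q a j a⊕j≡q (subst (λ z → ρ (a ⊕ z) < suc h) (sym 1+j≡k′) (proj₂ end-near))
          where
            end-near : Inner (a ⊕ k′) × ρ (a ⊕ k′) < suc h
            end-near = q-neighbour (subst (λ z → Edge Di z (a ⊕ k′)) a⊕j≡q (inward-edges {Di} e fan′ j j<k′))

    shrunk : Family t
    shrunk = Fs [ i ≔ pruned ]

    shrunk-i : shrunk i ≡ pruned
    shrunk-i = ≔-here Fs i pruned

    shrunk-other : ∀ {p} → p ≢ i → shrunk p ≡ Fs p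
    shrunk-other = ≔-there Fs pruned

    shrunk-edge : ∀ p {x z} → Edge (Fs p) x z → ∃[ p′ ] Edge (shrunk p′) x z
    shrunk-edge p {x} {z} e with p ≟ᶠ i
    ... | no p≢i = edge-in shrunk p (shrunk-other p≢i) e
    ... | yes refl with x ≟ᶠ q | z ≟ᶠ q
    ...   | yes refl | _ = edge-in shrunk mm (shrunk-other mm≢i) (edge-sym {Dm} (uncurry to-Dm (q-neighbour e)))
    ...   | no _ | yes refl = edge-in shrunk mm (shrunk-other mm≢i) (uncurry to-Dm (q-neighbour (edge-sym {Di} e)))
    ...   | no x≢q | no z≢q = edge-in shrunk i shrunk-i (prune e x≢q z≢q)

    shrunk-support : ∀ {a k′} → 2 ≤ k′ → k′ ≤ k → ∀ p → SupportedIn (Fs p) a k′ → SupportedBy shrunk a k′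
    shrunk-support {a} {k′} 2≤k′ k′≤k p s with p ≟ᶠ i
    ... | no p≢i = supportedIn-in shrunk p (shrunk-other p≢i) s
    ... | yes refl = [ supportedIn-in shrunk i shrunk-i , supportedIn-in shrunk mm (shrunk-other mm≢i) ] (split s)
      where
        split : SupportedIn Di a k′ → SupportedIn pruned a k′ ⊎ SupportedIn Dm a k′
        split (e , inj₁ fan′) = outward 2≤k′ (≤-<-trans k′≤k k<n) e fan′
        split (e , inj₂ fan′) = inward 2≤k′ (≤-<-trans k′≤k k<n) e fan′

    shrunk-unsupport : ∀ {a k′} → SupportedBy shrunk a k′ → SupportedBy Fs a k′
    shrunk-unsupport {a} {k′} (p , s) with p ≟ᶠ i
    ... | yes refl = i , supportedIn-map {pruned} {Di} unprune (subst (λ D → SupportedIn D a k′) shrunk-i s)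
    ... | no p≢i = p , subst (λ D → SupportedIn D a k′) (shrunk-other p≢i) s

    shrunk-within : InnerWithin (shrunk i) h
    shrunk-within {x} {z} s ix iz with subst (λ D → Spoke D x z) shrunk-i s
    ... | s′ , x≢q , z≢q =
      ρ≤1+h⇒ρ≤h {x} 1+h<n x≢q (proj₁ (within s′ ix iz)) , ρ≤1+h⇒ρ≤h {z} 1+h<n z≢q (proj₂ (within s′ ix iz))
      where
        1+h<n : suc h < n
        1+h<n = <-trans h<k k<n

    shrink : Shrunk Fs h
    shrink = shrunk , covers-redistribute Fs shrunk cov shrunk-edge ,
             (λ k′ a 2≤k′ k′≤k → supportedBy-redistribute Fs shrunk {a} {k′} (shrunk-support 2≤k′ k′≤k)) ,
             ¬sup ∘ shrunk-unsupport ,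
             subst (λ D → Spoke D c b) (sym shrunk-i) (cb , ≢-sym (inner⇒≢c inner-q) , ≢-sym (inner⇒≢b inner-q)) ,
             shrunk-within

  -- Either the repair finishes, or the inner spokes of Fs i retreat from distance 2 + h to 1 + h.
  step : ∀ Fs → Covers Fs → SupportedBelow k Fs → Spoke (Fs i) c b → ¬ SupportedBy Fs c k →
         ∀ h → suc (suc h) < k → InnerWithin (Fs i) (suc (suc h)) → Repaired k c Fs ⊎ Shrunk Fs (suc h)
  step Fs cov below cb ¬sup h h<k within with any? (λ y → edge? (Fs i) q y ×-dec inner? y)
    where
      q : V
      q = c ⊕ suc (suc h)
  ... | no isolated = inj₂ (Fs , cov , (λ _ _ _ _ s → s) , ¬sup , cb ,
                            within-pred {Fs i} (<-trans h<k k<n) (λ {y} e iy → isolated (y , e , iy)) within)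
  ... | yes (y , qy , iy) with below (suc (suc h)) (s≤s (s≤s z≤n)) h<k c
  ...   | mm , main , fan with mm ≟ᶠ i
  ...     | yes refl = ⊥-elim (inner⇒≢c iy (FanForest.leaf-of-c (Fs i) cb (inner-⊕ (s≤s z≤n) h<k) (edge-sym {Fs i} main) qy))
  ...     | no mm≢i with fan
  ...       | inj₁ outward-fan = inj₁ (Swap.swap Fs cov cb ¬sup (suc (suc h)) (s≤s (s≤s z≤n)) h<k within mm mm≢i main outward-fan)
  ...       | inj₂ inward-fan  = inj₂ (Remove.shrink Fs cov cb ¬sup (suc h) h<k within mm mm≢i main inward-fan y qy iy)

  Repairable : ℕ → Set₁
  Repairable h = ∀ Fs → Covers Fs → SupportedBelow k Fs → Spoke (Fs i) c b → ¬ SupportedBy Fs c k →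
                 InnerWithin (Fs i) h → Repaired k c Fs

  resume : ∀ Fs {h} → SupportedBelow k Fs → Repairable h → Shrunk Fs h → Repaired k c Fs
  resume Fs below continue (Fs′ , cov′ , pres , ¬sup′ , cb′ , within′)
    with continue Fs′ cov′ (preserves-below {k = k} {Fs} {Fs′} pres below) cb′ ¬sup′ within′
  ... | Fs″ , cov″ , pres′ , sup = Fs″ , cov″ , (λ k′ a 2≤k′ k′≤k → pres′ k′ a 2≤k′ k′≤k ∘ pres k′ a 2≤k′ k′≤k) , sup

  repair : ∀ h → h < k → Repairable h
  repair zero _ Fs cov _ cb _ within = Fill.fill Fs cov cb λ s ix iy → <⇒≱ (proj₁ ix) (proj₁ (within s ix iy))
  repair (suc zero) _ Fs cov _ cb _ within = Fill.fill Fs cov cb none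
    where
      at-one : ∀ {z} → Inner z → ρ z ≤ 1 → ρ z ≡ 1
      at-one iz ρz≤1 = ≤-antisym ρz≤1 (proj₁ iz)
      none : ∀ {x y} → Spoke (Fs i) x y → Inner x → Inner y → ⊥
      none {x} {y} s ix iy = irrefl (forest (Fs i)) s
        (offset-injective c (trans (at-one {x} ix (proj₁ (within s ix iy))) (sym (at-one {y} iy (proj₂ (within s ix iy))))))
  repair (suc (suc h)) h<k Fs cov below cb ¬sup within =
    [ id , resume Fs below (repair (suc h) (<-trans (n<1+n _) h<k)) ] (step Fs cov below cb ¬sup h h<k within)

  repair-centred : ∀ Fs → Covers Fs → SupportedBelow k Fs → Spoke (Fs i) c b → ¬ SupportedBy Fs c k → Repaired k c Fs
  repair-centred Fs cov below cb ¬sup = repair (pred k) pred[k]<k Fs cov below cb ¬sup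
    λ _ ix iy → suc[m]≤n⇒m≤pred[n] (proj₂ ix) , suc[m]≤n⇒m≤pred[n] (proj₂ iy)
    where
      pred[k]<k : pred k < k
      pred[k]<k = m≤pred[n]⇒suc[m]≤n {{>-nonZero (<-trans z<s 2≤k)}} ≤-refl

module Support (m : ℕ) where
  open Cycle m
  open Forests m
  open Reflection m

  module _ {t : ℕ} where

    reflect-covers : ∀ (Fs : Fin t → DecForest) → Covers Fs → Covers (reflect ∘ Fs)
    reflect-covers Fs cov x y x≢y = cov (op x) (op y) (x≢y ∘ op-injective)

    reflect-supportedBy : ∀ (Fs : Fin t → DecForest) {a k} → SupportedBy Fs a k → SupportedBy (reflect ∘ Fs) (mirror a k) k
    reflect-supportedBy Fs {a} {k} (p , s) = p , reflect-supportedIn {Fs p} a k s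

    reflect-supportedBy-mirror : ∀ (Fs : Fin t → DecForest) {a k} → SupportedBy Fs (mirror a k) k → SupportedBy (reflect ∘ Fs) a k
    reflect-supportedBy-mirror Fs {a} {k} s =
      subst (λ z → SupportedBy (reflect ∘ Fs) z k) (mirror-involutive a k) (reflect-supportedBy Fs {mirror a k} {k} s)

    unreflect-supportedBy : ∀ (Fs : Fin t → DecForest) {a k} → SupportedBy (reflect ∘ Fs) (mirror a k) k → SupportedBy Fs a k
    unreflect-supportedBy Fs {a} {k} s with reflect-supportedBy (reflect ∘ Fs) {mirror a k} {k} s
    ... | p , s′ = p , supportedIn-map {reflect (reflect (Fs p))} {Fs p} (reflect²-edge {Fs p})
                         (subst (λ z → SupportedIn (reflect (reflect (Fs p))) z k) (mirror-involutive a k) s′)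

    -- Reflection turns a k-edge whose spoke is centred at its far end into one centred at its near end.
    reflect-repaired : ∀ {k a} (Fs : Fin t → DecForest) → Repaired k (mirror a k) (reflect ∘ Fs) → Repaired k a Fs
    reflect-repaired {k} {a} Fs (Fs′ , cov′ , pres , sup) =
      reflect ∘ Fs′ , reflect-covers Fs′ cov′ ,
      (λ k′ b 2≤k′ k′≤k → reflect-supportedBy-mirror Fs′ {b} {k′} ∘ pres k′ (mirror b k′) 2≤k′ k′≤k
                           ∘ reflect-supportedBy Fs {b} {k′}) ,
      reflect-supportedBy-mirror Fs′ {a} {k} sup

    c≢c⊕k : ∀ c {k} → 0 < k → k < n → c ≢ c ⊕ k
    c≢c⊕k c {k} 0<k k<n eq = <-irrefl (⊕-cancel-< c {0} {k} (s≤s z≤n) k<n (trans (⊕-identityʳ c) eq)) 0<k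

    support-vertex : ∀ {k} → 2 ≤ k → k < n → ∀ (Fs : Family t) → Covers Fs → SupportedBelow k Fs → ∀ c → Repaired k c Fs
    support-vertex {k} 2≤k k<n Fs cov below c with supportedBy? Fs c k
    ... | yes sup = Fs , cov , (λ _ _ _ _ s → s) , sup
    ... | no ¬sup with cov c (c ⊕ k) (c≢c⊕k c (<-trans z<s 2≤k) k<n)
    ...   | i , inj₁ cb = Repair.repair-centred m c k k<n 2≤k i Fs cov below cb ¬sup
    ...   | i , inj₂ bc = reflect-repaired Fs
                            (Repair.repair-centred m (mirror c k) k k<n 2≤k i (reflect ∘ Fs) (reflect-covers Fs cov) below′ cb′ ¬sup′)
      where
        below′ : SupportedBelow k (reflect ∘ Fs)
        below′ k′ 2≤k′ k′<k a = reflect-supportedBy-mirror Fs {a} {k′} (below k′ 2≤k′ k′<k (mirror a k′))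
        cb′ : Spoke (reflect (Fs i)) (mirror c k) (mirror c k ⊕ k)
        cb′ = subst₂ (Spoke (Fs i)) (sym (opposite-involutive (c ⊕ k))) (sym (mirror-involutive c k)) bc
        ¬sup′ : ¬ SupportedBy (reflect ∘ Fs) (mirror c k) k
        ¬sup′ = ¬sup ∘ unreflect-supportedBy Fs

    support-vertices : ∀ {k} → 2 ≤ k → k < n → ∀ (Fs : Family t) → Covers Fs → SupportedBelow k Fs → ∀ r → r ≤ n →
      Σ (Family t) λ Fs′ → Covers Fs′ × SupportedBelow k Fs′ × (∀ a → toℕ a < r → SupportedBy Fs′ a k)
    support-vertices 2≤k k<n Fs cov below zero _ = Fs , cov , below , λ _ ()
    support-vertices {k} 2≤k k<n Fs cov below (suc r) r<n
      with support-vertices 2≤k k<n Fs cov below r (<⇒≤ r<n)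
    ... | Fs₁ , cov₁ , below₁ , done₁ with support-vertex 2≤k k<n Fs₁ cov₁ below₁ (fromℕ< r<n)
    ...   | Fs₂ , cov₂ , pres , sup = Fs₂ , cov₂ , preserves-below {k = k} {Fs₁} {Fs₂} pres below₁ , done₂
      where
        done₂ : ∀ a → toℕ a < suc r → SupportedBy Fs₂ a k
        done₂ a a<1+r with m≤n⇒m<n∨m≡n (≤-pred a<1+r)
        ... | inj₁ a<r = pres k a 2≤k ≤-refl (done₁ a a<r)
        ... | inj₂ a≡r = subst (λ z → SupportedBy Fs₂ z k) (toℕ-injective (trans (toℕ-fromℕ< r<n) (sym a≡r))) sup

    support-level : ∀ {k} → 2 ≤ k → k < n → ∀ (Fs : Family t) → Covers Fs → SupportedBelow k Fs →
                    Σ (Family t) λ Fs′ → Covers Fs′ × SupportedBelow (suc k) Fs′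
    support-level {k} 2≤k k<n Fs cov below with support-vertices 2≤k k<n Fs cov below n ≤-refl
    ... | Fs′ , cov′ , below′ , all = Fs′ , cov′ , below″
      where
        below″ : SupportedBelow (suc k) Fs′
        below″ k′ 2≤k′ k′<1+k a with m≤n⇒m<n∨m≡n (≤-pred k′<1+k)
        ... | inj₁ k′<k = below′ k′ 2≤k′ k′<k a
        ... | inj₂ refl = all a (toℕ<n a)

    support-levels : ∀ k → k < n → ∀ (Fs : Family t) → Covers Fs → Σ (Family t) λ Fs′ → Covers Fs′ × SupportedBelow (suc k) Fs′
    support-levels zero _ Fs cov = Fs , cov , λ _ 2≤k′ k′<1 _ → ⊥-elim (<⇒≱ 2≤k′ (≤-trans (≤-pred k′<1) z≤n))
    support-levels (suc zero) _ Fs cov = Fs , cov , λ _ 2≤k′ k′<2 _ → ⊥-elim (<⇒≱ 2≤k′ (≤-pred k′<2))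
    support-levels (suc (suc k)) k<n Fs cov with support-levels (suc k) (<-trans (n<1+n _) k<n) Fs cov
    ... | Fs′ , cov′ , below′ = support-level (s≤s (s≤s z≤n)) k<n Fs′ cov′ below′

  -- For every pair x < y, the covering G chooses one forest containing x y; keeping only the chosen
  -- spokes yields decidable plane star-forests that still cover K_n.
  module Canonical {t : ℕ} (G : Fin t → PlaneStarForest n) (cov : Covering G) where

    Choice : V → V → Set
    Choice x y = ∃[ j ] HasEdge (G j) x y

    choice : ∀ {x y} → x <ᶠ y → Choice x y
    choice {x} {y} x<y = cov x y (λ { refl → <-irrefl refl x<y })

    CentredFirst CentredSecond : Fin t → ∀ {x y} → Choice x y → Set
    CentredFirst  i (j , inj₁ _) = j ≡ i
    CentredFirst  i (j , inj₂ _) = ⊥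
    CentredSecond i (j , inj₁ _) = ⊥
    CentredSecond i (j , inj₂ _) = j ≡ i

    centredFirst? : ∀ i {x y} (r : Choice x y) → Dec (CentredFirst i r)
    centredFirst? i (j , inj₁ _) = j ≟ᶠ i
    centredFirst? i (j , inj₂ _) = no λ ()

    centredSecond? : ∀ i {x y} (r : Choice x y) → Dec (CentredSecond i r)
    centredSecond? i (j , inj₁ _) = no λ ()
    centredSecond? i (j , inj₂ _) = j ≟ᶠ i

    centredFirst⇒star : ∀ i {x y} (r : Choice x y) → CentredFirst i r → Star (G i) x y
    centredFirst⇒star i (j , inj₁ s) refl = s

    centredSecond⇒star : ∀ i {x y} (r : Choice x y) → CentredSecond i r → Star (G i) y x
    centredSecond⇒star i (j , inj₂ s) refl = s

    Chosen : Fin t → V → V → Set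
    Chosen i x y = (Σ (x <ᶠ y) λ x<y → CentredFirst i (choice x<y)) ⊎ (Σ (y <ᶠ x) λ y<x → CentredSecond i (choice y<x))

    chosen⇒star : ∀ i {x y} → Chosen i x y → Star (G i) x y
    chosen⇒star i (inj₁ (x<y , p)) = centredFirst⇒star i (choice x<y) p
    chosen⇒star i (inj₂ (y<x , p)) = centredSecond⇒star i (choice y<x) p

    Σ<-dec : ∀ {x y : V} {P : x <ᶠ y → Set} → (∀ x<y → Dec (P x<y)) → Dec (Σ (x <ᶠ y) P)
    Σ<-dec {x} {y} {P} P? with x <ᶠ? y
    ... | no x≮y = no (x≮y ∘ proj₁)
    ... | yes x<y with P? x<y
    ...   | yes p = yes (x<y , p)
    ...   | no ¬p = no λ (x<y′ , p) → ¬p (subst P (<ᶠ-irrelevant x<y′ x<y) p)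

    chosen? : ∀ i x y → Dec (Chosen i x y)
    chosen? i x y = Σ<-dec (centredFirst? i ∘ choice) ⊎-dec Σ<-dec (centredSecond? i ∘ choice)

    canonical : Family t
    canonical i = record
      { forest = record
        { Star        = Chosen i
        ; irrefl      = irrefl (G i) ∘ chosen⇒star i
        ; leaf-no-ctr = λ s s′ → leaf-no-ctr (G i) (chosen⇒star i s) (chosen⇒star i s′)
        ; uniq-ctr    = λ s s′ → uniq-ctr (G i) (chosen⇒star i s) (chosen⇒star i s′)
        ; noncrossing = λ s s′ → noncrossing (G i) (chosen⇒star i s) (chosen⇒star i s′) }
      ; star? = chosen? i }

    canonical-covers : Covers canonical
    canonical-covers x y x≢y with <ᶠ-cmp x y
    ... | tri≈ _ x≡y _ = ⊥-elim (x≢y x≡y)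
    ... | tri< x<y _ _ = chosen-edge (choice x<y) refl
      where
        chosen-edge : (r : Choice x y) → r ≡ choice x<y → ∃[ i ] Edge (canonical i) x y
        chosen-edge (j , inj₁ _) eq = j , inj₁ (inj₁ (x<y , subst (CentredFirst j) eq refl))
        chosen-edge (j , inj₂ _) eq = j , inj₂ (inj₂ (x<y , subst (CentredSecond j) eq refl))
    ... | tri> _ _ y<x = chosen-edge (choice y<x) refl
      where
        chosen-edge : (r : Choice y x) → r ≡ choice y<x → ∃[ i ] Edge (canonical i) x y
        chosen-edge (j , inj₁ _) eq = j , inj₂ (inj₁ (y<x , subst (CentredFirst j) eq refl))
        chosen-edge (j , inj₂ _) eq = j , inj₁ (inj₂ (y<x , subst (CentredSecond j) eq refl))

lemma1 : (n : ℕ) → 3 ≤ n → (t : ℕ) → 1 ≤ t →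
    (∃[ G ] Covering {n} {t} G) →
    (k : ℕ) → 1 < k → k < n →
    ∃[ F ] (Covering {n} {t} F ×
      (∀ k′ → 1 < k′ → k′ ≤ k → ∀ (a : Fin n) → Supported F a k′))
lemma1 (suc m) _ t _ (G , cov) k _ k<n =
  let Fs , covers , supported = support-levels k k<n canonical canonical-covers
  in forest ∘ Fs , covers , λ k′ 2≤k′ k′≤k → supported k′ 2≤k′ (s≤s k′≤k)
  where
    open Forests m
    open Support m
    open Canonical G cov
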